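{- For every $n\ge1$, the number of shallow $321$-avoiding persymmetric permutations of length $n$ is $F_{n+1}$, the $(n+1)$-st Fibonacci number.
   Context: For $\pi=\pi_1\cdots\pi_n \in S_n$: $D(\pi)=\sum_{i=1}^n|\pi_i-i|$; $I(\pi)=|\{(i,j): i<j,\ \pi_i>\pi_j\}|$; $T(\pi)=n-\mathrm{cyc}(\pi)$ where $\mathrm{cyc}(\pi)$ is the number of cycles of $\pi$. $\pi$ is shallow if $I(\pi)+T(\pi)=D(\pi)$. $\pi$ avoids $321$ if there are no $i<j<k$ with $\pi_i>\pi_j>\pi_k$. The reverse-complement $\pi^{rc}$ is defined by $\pi^{rc}_{n+1-i}=n+1-\pi_i$, and $\pi^{rci}=(\pi^{rc})^{ -1}$; $\pi$ is persymmetric if $\pi=\pi^{rci}$. Fibonacci numbers: $F_1=F_2=1$, $F_m=F_{m-1}+F_{m-2}$. -}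

module Defs where

-- Permutations of length n are represented in one-line notation as vectors
-- v : Vec (Fin n) n (0-indexed: v[i] = π_{i+1} - 1); v is a permutation iff
-- its entries are pairwise distinct.

open import Data.Nat using (ℕ; zero; suc; _+_; _∸_; _<ᵇ_; _≡ᵇ_; ∣_-_∣)
open import Data.Bool using (Bool; true; false; _∧_; _∨_; not; T)
open import Data.Fin using (Fin; toℕ)
open import Data.Vec using (Vec; []; _∷_; lookup)
open import Data.List using (List; []; _∷_; [_]; map; concatMap; filter; length)
open import Data.Nat.ListAction using (sum)
open import Data.Bool.ListAction using (all; any)
open import Data.Fin using () renaming (zero to fzero)
import Data.List as L

allFin : (n : ℕ) → List (Fin n)
allFin n = L.allFin n

allVecs : (n m : ℕ) → List (Vec (Fin n) m)
allVecs n zero = [ [] ]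
allVecs n (suc m) = concatMap (λ x → map (x ∷_) (allVecs n m)) (allFin n)

module _ {n : ℕ} (v : Vec (Fin n) n) where

  π : Fin n → ℕ
  π i = toℕ (lookup v i)

  _≺_ : Fin n → Fin n → Bool
  i ≺ j = toℕ i <ᵇ toℕ j

  isPerm : Bool
  isPerm = all (λ i → all (λ j → not (i ≺ j) ∨ not (π i ≡ᵇ π j)) (allFin n)) (allFin n)

  Dis : ℕ
  Dis = sum (map (λ i → ∣ π i - toℕ i ∣) (allFin n))

  Inv : ℕ
  Inv = sum (map (λ i → length (filter (λ j → T? ((i ≺ j) ∧ (π j <ᵇ π i))) (allFin n))) (allFin n))
    where
    open import Relation.Nullary using (Dec)
    open import Data.Bool.Properties using (T?)

  iter : ℕ → Fin n → Fin n
  iter zero i = i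
  iter (suc k) i = lookup v (iter k i)

  cycMin : Fin n → Bool
  cycMin i = all (λ k → not (toℕ (iter (suc k) i) <ᵇ toℕ i)) (L.upTo n)

  -- cyc(π) = number of cycles = number of cycle-minimal elements
  cyc : ℕ
  cyc = length (filter (λ i → Data.Bool.Properties.T? (cycMin i)) (allFin n))
    where import Data.Bool.Properties

  Tr : ℕ
  Tr = n ∸ cyc

  shallow : Bool
  shallow = (Inv + Tr) ≡ᵇ Dis

  avoids321 : Bool
  avoids321 = not (any (λ i → any (λ j → any (λ k →
      (i ≺ j) ∧ (j ≺ k) ∧ (π j <ᵇ π i) ∧ (π k <ᵇ π j))
      (allFin n)) (allFin n)) (allFin n))

  rc : Fin n → ℕ
  rc j = (n ∸ 1) ∸ π (Data.Fin.opposite j)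

  -- persymmetric: π = (π^rc)^{-1}, i.e. π^rc(π(i)) = i for all i
  persymmetric : Bool
  persymmetric = all (λ i → rc (lookup v i) ≡ᵇ toℕ i) (allFin n)

  good : Bool
  good = isPerm ∧ shallow ∧ avoids321 ∧ persymmetric

countGood : ℕ → ℕ
countGood n = length (filter (λ v → Data.Bool.Properties.T? (good v)) (allVecs n n))
  where import Data.Bool.Properties

F : ℕ → ℕ
F zero = 0
F (suc zero) = 1
F (suc (suc m)) = F (suc m) + F m

{-# OPTIONS --safe #-}
-- Write c(a) for the number of arcs i < a ≤ π(i) crossing the cut a of a permutation π of
-- {0, …, n-1}.  Counting the pairs (i, a) gives D(π) = 2 Σₐ c(a), and in a 321-avoiding π
-- every entry has inversions on one side only, so I(π) = Σᵢ (π(i) ∸ i) = Σₐ c(a).  Every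
-- uncrossed cut a is the minimum of its cycle; conversely, if π avoids 321 and no cut is
-- crossed twice, every cycle minimum is an uncrossed cut.  As Σₐ c(a) + #{a : c(a) = 0} ≥ n,
-- with equality iff no cut is crossed twice, a 321-avoiding π is shallow iff no cut is
-- crossed twice.
--
-- Let π be such a permutation which is moreover persymmetric, of length m + 2.  If π(0) = 0
-- then π = 1 ⊕ σ ⊕ 1.  If π(0) = 1 then π(m) = m + 1 and (0 1) π (m m+1) = 1 ⊕ σ ⊕ 1.  If
-- π(0) ≥ 2 then π(1) = 0, π(m+1) = m and (m m+1) π (0 1) = 1 ⊕ σ ⊕ 1 with σ(0) ≠ 0.  In each
-- case σ is again of this kind, and conversely each construction yields such a permutation.
-- So if there are b_n of them, y_n with π(0) ≠ 0, then b_{m+2} = 2 b_m + y_m and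
-- y_{m+2} = b_m + y_m, and b_2 = 2, y_2 = 1, b_3 = 3, y_3 = 2 give b_n = F_{n+1}.

module Submission where

open import Defs
open import Data.Nat
open import Data.Nat.Properties
open import Data.Nat.ListAction using (sum)
open import Data.Bool using (Bool; true; false; not; _∧_; _∨_; T; if_then_else_)
open import Data.Bool.ListAction using (all; any; and)
open import Data.Fin using (Fin; toℕ; fromℕ<; opposite) renaming (zero to fzero; suc to fsuc)
open import Data.Fin.Properties using (pigeonhole; toℕ-fromℕ<; toℕ<n; toℕ-injective; opposite-prop)
open import Data.Vec using (Vec; []; _∷_; lookup)
import Data.Vec as Vec
open import Data.Vec.Properties using (lookup∘tabulate; ∷-injective)
open import Data.List
  using (List; []; _∷_; map; filter; length; _++_; concatMap; cartesianProductWith; tabulate; upTo)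
open import Data.List.Properties using (map-cong; length-++; length-map)
open import Data.List.Membership.Propositional using (_∈_; find)
open import Data.List.Membership.Propositional.Properties
  using ( ∈-upTo⁺; ∈-upTo⁻; ∈-allFin; ∈-filter⁺; ∈-filter⁻; ∈-map⁺; ∈-map⁻; ∈-++⁺ˡ; ∈-++⁺ʳ; ∈-++⁻
        ; ∈-cartesianProductWith⁺)
open import Data.List.Membership.Propositional.Properties.WithK using (unique∧set⇒bag)
open import Data.List.Relation.Binary.BagAndSetEquality using (∼bag⇒↭)
open import Data.List.Relation.Binary.Permutation.Propositional.Properties using (↭-length)
import Data.List.Relation.Unary.All as All
open import Data.List.Relation.Unary.All.Properties using (all⁺; all⁻)
import Data.List.Relation.Unary.AllPairs as AllPairs
open import Data.List.Relation.Unary.Any as Any using (here)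
open import Data.List.Relation.Unary.Any.Properties using (any⁺; any⁻)
open import Data.List.Relation.Unary.Unique.Propositional using (Unique)
import Data.List.Relation.Unary.Unique.Propositional.Properties as Unique
open import Data.Product using (∃-syntax; _×_; _,_; proj₁; proj₂; swap)
open import Data.Sum using (_⊎_; inj₁; inj₂)
open import Data.Empty using (⊥; ⊥-elim)
open import Function.Base using (_∘_; id)
open import Function.Bundles using (Equivalence; _⇔_; mk⇔)
open import Relation.Nullary using (¬_; Dec; yes; no; does; contradiction; ¬?; _×-dec_)
open import Relation.Nullary.Decidable using (T?)
open import Relation.Unary using (Decidable)
open import Relation.Binary.Definitions using (tri<; tri≈; tri>)
open import Relation.Binary.PropositionalEquality
open import Algebra.Properties.CommutativeSemigroup +-commutativeSemigroup using (interchange; xy∙z≈xz∙y)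


-- Finite sums and counts

sum< : ℕ → (ℕ → ℕ) → ℕ
sum< zero    f = 0
sum< (suc n) f = sum< n f + f n

sum<-cong : ∀ n {f g} → (∀ i → i < n → f i ≡ g i) → sum< n f ≡ sum< n g
sum<-cong zero    f≡g = refl
sum<-cong (suc n) f≡g =
  cong₂ _+_ (sum<-cong n (λ i i<n → f≡g i (m<n⇒m<1+n i<n))) (f≡g n ≤-refl)

sum<-zero : ∀ n {f} → (∀ i → i < n → f i ≡ 0) → sum< n f ≡ 0
sum<-zero n f≡0 = trans (sum<-cong n f≡0) (zeros n)
  where
  zeros : ∀ n → sum< n (λ _ → 0) ≡ 0
  zeros zero    = refl
  zeros (suc n) = cong (_+ 0) (zeros n)

sum<-ones : ∀ n → sum< n (λ _ → 1) ≡ n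
sum<-ones zero    = refl
sum<-ones (suc n) = trans (cong (_+ 1) (sum<-ones n)) (+-comm n 1)

sum<-+ : ∀ n f g → sum< n (λ i → f i + g i) ≡ sum< n f + sum< n g
sum<-+ zero    f g = refl
sum<-+ (suc n) f g =
  trans (cong (_+ (f n + g n)) (sum<-+ n f g)) (interchange (sum< n f) (sum< n g) (f n) (g n))

sum<-comm : ∀ n m (g : ℕ → ℕ → ℕ) →
            sum< n (λ i → sum< m (g i)) ≡ sum< m (λ j → sum< n (λ i → g i j))
sum<-comm zero    m g = sym (sum<-zero m (λ _ _ → refl))
sum<-comm (suc n) m g =
  trans (cong (_+ sum< m (g n)) (sum<-comm n m g))
        (sym (sum<-+ m (λ j → sum< n (λ i → g i j)) (g n)))

sum<-front : ∀ n f → sum< (suc n) f ≡ f 0 + sum< n (λ i → f (suc i))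
sum<-front zero    f = +-comm 0 (f 0)
sum<-front (suc n) f = trans (cong (_+ f (suc n)) (sum<-front n f)) (+-assoc (f 0) _ _)

sum<-mono-≤ : ∀ n {f g} → (∀ i → i < n → f i ≤ g i) → sum< n f ≤ sum< n g
sum<-mono-≤ zero    f≤g = z≤n
sum<-mono-≤ (suc n) f≤g =
  +-mono-≤ (sum<-mono-≤ n (λ i i<n → f≤g i (m<n⇒m<1+n i<n))) (f≤g n ≤-refl)

sum<-positive : ∀ n {f} → (∀ i → i < n → 1 ≤ f i) → n ≤ sum< n f
sum<-positive n {f} 1≤f = subst (_≤ sum< n f) (sum<-ones n) (sum<-mono-≤ n 1≤f)

sum<-positive-strict : ∀ n {f} → (∀ i → i < n → 1 ≤ f i) →
                       ∀ i₀ → i₀ < n → 2 ≤ f i₀ → suc n ≤ sum< n f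
sum<-positive-strict (suc n) {f} 1≤f i₀ i₀<1+n 2≤f with m≤n⇒m<n∨m≡n (≤-pred i₀<1+n)
... | inj₂ refl =
  subst (_≤ sum< n f + f n) (+-comm n 2)
        (+-mono-≤ (sum<-positive n (λ i i<n → 1≤f i (m<n⇒m<1+n i<n))) 2≤f)
... | inj₁ i₀<n =
  subst (_≤ sum< n f + f n) (+-comm (suc n) 1)
        (+-mono-≤ (sum<-positive-strict n (λ i i<n → 1≤f i (m<n⇒m<1+n i<n)) i₀ i₀<n 2≤f)
                  (1≤f n ≤-refl))

∣-∣≡∸+∸ : ∀ m n → ∣ m - n ∣ ≡ (m ∸ n) + (n ∸ m)
∣-∣≡∸+∸ zero    zero    = refl
∣-∣≡∸+∸ zero    (suc n) = refl
∣-∣≡∸+∸ (suc m) zero    = sym (+-identityʳ _)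
∣-∣≡∸+∸ (suc m) (suc n) = ∣-∣≡∸+∸ m n

m∸x≡suc[m∸1∸x] : ∀ {m x} → x < m → m ∸ x ≡ suc ((m ∸ 1) ∸ x)
m∸x≡suc[m∸1∸x] {suc m} (s≤s x≤m) = +-∸-assoc 1 x≤m

m∸1∸x<m : ∀ m x → 0 < m → (m ∸ 1) ∸ x < m
m∸1∸x<m (suc m) x _ = s≤s (m∸n≤m m x)

1+m∸x≡1⇒x≡m : ∀ m x → x ≤ suc m → suc m ∸ x ≡ 1 → x ≡ m
1+m∸x≡1⇒x≡m m x x≤1+m eq = suc-injective (trans (sym (cong (_+ x) eq)) (m∸n+n≡m x≤1+m))

indicator : ∀ {A : Set} → Dec A → ℕ
indicator d = if does d then 1 else 0

indicator-no : ∀ {A : Set} (a : Dec A) → ¬ A → indicator a ≡ 0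
indicator-no (yes a) ¬a = contradiction a ¬a
indicator-no (no  _) _  = refl

count< : ℕ → {P : ℕ → Set} → Decidable P → ℕ
count< zero    P? = 0
count< (suc n) P? = count< n P? + indicator (P? n)

module _ {P : ℕ → Set} (P? : Decidable P) where

  count<≡sum< : (n : ℕ) → count< n P? ≡ sum< n (λ i → indicator (P? i))
  count<≡sum< zero    = refl
  count<≡sum< (suc n) = cong (_+ indicator (P? n)) (count<≡sum< n)

  count<-none : (n : ℕ) → (∀ i → i < n → ¬ P i) → count< n P? ≡ 0
  count<-none zero    ¬P = refl
  count<-none (suc n) ¬P with P? n
  ... | yes p = contradiction p (¬P n ≤-refl)
  ... | no  _ = cong (_+ 0) (count<-none n (λ i i<n → ¬P i (m<n⇒m<1+n i<n)))

  count<-all : (n : ℕ) → (∀ i → i < n → P i) → count< n P? ≡ n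
  count<-all zero    _ = refl
  count<-all (suc n) P-all with P? n
  ... | yes _ = trans (cong (_+ 1) (count<-all n (λ i i<n → P-all i (m<n⇒m<1+n i<n)))) (+-comm n 1)
  ... | no ¬p = contradiction (P-all n ≤-refl) ¬p

  count<-witness : (n : ℕ) → 1 ≤ count< n P? → ∃[ j ] (j < n × P j)
  count<-witness (suc n) 1≤c with P? n
  ... | yes p = n , ≤-refl , p
  ... | no  _ with count<-witness n (subst (1 ≤_) (+-identityʳ _) 1≤c)
  ...   | j , j<n , p = j , m<n⇒m<1+n j<n , p

  count<-≥1 : (n j : ℕ) → j < n → P j → 1 ≤ count< n P?
  count<-≥1 (suc n) j j<1+n p with m≤n⇒m<n∨m≡n (≤-pred j<1+n)
  ... | inj₁ j<n  = ≤-trans (count<-≥1 n j j<n p) (m≤m+n _ _)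
  ... | inj₂ refl with P? n
  ...   | yes _ = m≤n+m 1 _
  ...   | no ¬p = contradiction p ¬p

  count<-≤1 : (n : ℕ) → (∀ i j → i < n → j < n → P i → P j → i ≡ j) → count< n P? ≤ 1
  count<-≤1 zero    uniq = z≤n
  count<-≤1 (suc n) uniq with P? n
  ... | no  _ = subst (_≤ 1) (sym (+-identityʳ _))
                  (count<-≤1 n (λ i j i<n j<n → uniq i j (m<n⇒m<1+n i<n) (m<n⇒m<1+n j<n)))
  ... | yes p = ≤-reflexive (cong (_+ 1) (count<-none n (λ i i<n pi →
                  <-irrefl (uniq i n (m<n⇒m<1+n i<n) ≤-refl pi p) i<n)))

count<-cong : (n : ℕ) {P Q : ℕ → Set} {P? : Decidable P} {Q? : Decidable Q} →
              (∀ i → i < n → P i → Q i) → (∀ i → i < n → Q i → P i) → count< n P? ≡ count< n Q?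
count<-cong zero            P⇒Q Q⇒P = refl
count<-cong (suc n) {P? = P?} {Q?} P⇒Q Q⇒P =
  cong₂ _+_ (count<-cong n (λ i i<n → P⇒Q i (m<n⇒m<1+n i<n)) (λ i i<n → Q⇒P i (m<n⇒m<1+n i<n)))
            (same (P? n) (Q? n) (P⇒Q n ≤-refl) (Q⇒P n ≤-refl))
  where
  same : ∀ {A B : Set} (a : Dec A) (b : Dec B) → (A → B) → (B → A) → indicator a ≡ indicator b
  same (yes _) (yes _) _   _   = refl
  same (no  _) (no  _) _   _   = refl
  same (yes a) (no ¬b) a⇒b _   = contradiction (a⇒b a) ¬b
  same (no ¬a) (yes b) _   b⇒a = contradiction (b⇒a b) ¬a

count<-mono : (n : ℕ) {P Q : ℕ → Set} {P? : Decidable P} {Q? : Decidable Q} →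
              (∀ i → i < n → P i → Q i) → count< n P? ≤ count< n Q?
count<-mono zero            P⇒Q = z≤n
count<-mono (suc n) {P? = P?} {Q?} P⇒Q =
  +-mono-≤ (count<-mono n (λ i i<n → P⇒Q i (m<n⇒m<1+n i<n))) (pointwise (P? n) (Q? n) (P⇒Q n ≤-refl))
  where
  pointwise : ∀ {A B : Set} (a : Dec A) (b : Dec B) → (A → B) → indicator a ≤ indicator b
  pointwise (no  _) _       _   = z≤n
  pointwise (yes _) (yes _) _   = ≤-refl
  pointwise (yes a) (no ¬b) a⇒b = contradiction (a⇒b a) ¬b

count<-split : {P Q : ℕ → Set} (P? : Decidable P) (Q? : Decidable Q) (n : ℕ) →
               count< n P? ≡ count< n (λ i → P? i ×-dec Q? i) + count< n (λ i → P? i ×-dec ¬? (Q? i))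
count<-split P? Q? zero    = refl
count<-split P? Q? (suc n) =
  trans (cong₂ _+_ (count<-split P? Q? n) (split (P? n) (Q? n)))
        (interchange (count< n (λ i → P? i ×-dec Q? i)) (count< n (λ i → P? i ×-dec ¬? (Q? i))) _ _)
  where
  split : ∀ {A B : Set} (a : Dec A) (b : Dec B) →
          indicator a ≡ indicator (a ×-dec b) + indicator (a ×-dec ¬? b)
  split (yes _) (yes _) = refl
  split (yes _) (no  _) = refl
  split (no  _) _       = refl

count<-complement : {P : ℕ → Set} (P? : Decidable P) (n : ℕ) →
                    count< n P? + count< n (λ i → ¬? (P? i)) ≡ n
count<-complement P? zero    = refl
count<-complement P? (suc n) =
  trans (interchange (count< n P?) (indicator (P? n)) (count< n (λ i → ¬? (P? i))) _)
        (trans (cong₂ _+_ (count<-complement P? n) (one (P? n))) (+-comm n 1))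
  where
  one : ∀ {A : Set} (a : Dec A) → indicator a + indicator (¬? a) ≡ 1
  one (yes _) = refl
  one (no  _) = refl

count<-≤ : {P : ℕ → Set} (P? : Decidable P) (n : ℕ) → count< n P? ≤ n
count<-≤ P? n = subst (count< n P? ≤_) (count<-complement P? n) (m≤m+n _ _)

count<-≥2 : {P : ℕ → Set} (P? : Decidable P) (n i j : ℕ) → i < n → j < n → i ≢ j → P i → P j →
            2 ≤ count< n P?
count<-≥2 P? n i j i<n j<n i≢j pi pj =
  subst (2 ≤_) (sym (count<-split P? (_≟ i) n))
    (+-mono-≤ (count<-≥1 _ n i i<n (pi , refl)) (count<-≥1 _ n j j<n (pj , λ j≡i → i≢j (sym j≡i))))

count<-injection : {P : ℕ → Set} (P? : Decidable P) (x n : ℕ) (g : ℕ → ℕ) →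
                   (∀ j → j < n → P j → g j < x) →
                   (∀ i j → i < n → j < n → P i → P j → g i ≡ g j → i ≡ j) →
                   count< n P? ≤ x
count<-injection P? zero    n g g<x inj =
  ≤-reflexive (count<-none P? n (λ j j<n pj → n≮0 (g<x j j<n pj)))
count<-injection {P} P? (suc x) n g g<x inj =
  subst (_≤ suc x) (sym (count<-split P? (λ j → g j <? x) n))
    (subst (count< n (λ j → P? j ×-dec (g j <? x)) + count< n (λ j → P? j ×-dec ¬? (g j <? x)) ≤_)
           (+-comm x 1) (+-mono-≤ below atTop))
  where
  below : count< n (λ j → P? j ×-dec (g j <? x)) ≤ x
  below = count<-injection _ x n g (λ _ _ (_ , gj<x) → gj<x)
            (λ i j i<n j<n (pi , _) (pj , _) → inj i j i<n j<n pi pj)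
  g≡x : ∀ {j} → j < n → P j × ¬ g j < x → g j ≡ x
  g≡x {j} j<n (pj , gj≮x) = ≤-antisym (≤-pred (g<x j j<n pj)) (≮⇒≥ gj≮x)
  atTop : count< n (λ j → P? j ×-dec ¬? (g j <? x)) ≤ 1
  atTop = count<-≤1 _ n (λ i j i<n j<n ti tj →
            inj i j i<n j<n (proj₁ ti) (proj₁ tj) (trans (g≡x i<n ti) (sym (g≡x j<n tj))))

count<-< : ∀ n x → x ≤ n → count< n (_<? x) ≡ x
count<-< zero    zero    _ = refl
count<-< (suc n) x x≤1+n with m≤n⇒m<n∨m≡n x≤1+n
... | inj₂ refl = count<-all (_<? x) (suc n) (λ _ i<x → i<x)
... | inj₁ x<1+n = trans (cong₂ _+_ (count<-< n x (≤-pred x<1+n))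
                                    (indicator-no (n <? x) (≤⇒≯ (≤-pred x<1+n))))
                         (+-identityʳ x)

count<-interval : ∀ n j y → y < n → count< n (λ a → (j <? a) ×-dec (a ≤? y)) ≡ y ∸ j
count<-interval n j y y<n with j ≤? y
... | no j≰y = trans (count<-none _ n (λ a _ (j<a , a≤y) → j≰y (≤-trans (<⇒≤ j<a) a≤y)))
                     (sym (m≤n⇒m∸n≡0 (<⇒≤ (≰⇒> j≰y))))
... | yes j≤y = +-cancelˡ-≡ (suc j) _ _ (begin
    suc j + count< n inside                                          ≡⟨ cong₂ _+_ upToJ sameInside ⟨
    count< n (λ a → (a <? suc y) ×-dec (a <? suc j)) + count< n (λ a → (a <? suc y) ×-dec ¬? (a <? suc j))
                                                                     ≡⟨ count<-split (_<? suc y) (_<? suc j) n ⟨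
    count< n (_<? suc y)                                             ≡⟨ count<-< n (suc y) y<n ⟩
    suc y                                                            ≡⟨ cong suc (m+[n∸m]≡n j≤y) ⟨
    suc j + (y ∸ j)                                                  ∎)
  where
  open ≡-Reasoning
  inside : ∀ a → Dec (j < a × a ≤ y)
  inside a = (j <? a) ×-dec (a ≤? y)
  upToJ : count< n (λ a → (a <? suc y) ×-dec (a <? suc j)) ≡ suc j
  upToJ = trans (count<-cong n (λ _ _ → proj₂) (λ a _ a<1+j → ≤-trans a<1+j (s≤s j≤y) , a<1+j))
                (count<-< n (suc j) (≤-trans (s≤s j≤y) y<n))
  sameInside : count< n (λ a → (a <? suc y) ×-dec ¬? (a <? suc j)) ≡ count< n inside
  sameInside = count<-cong n (λ _ _ (a<1+y , a≮1+j) → ≮⇒≥ a≮1+j , ≤-pred a<1+y)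
                             (λ _ _ (j<a , a≤y) → s≤s a≤y , <⇒≱ j<a ∘ ≤-pred)

T-not⁺ : ∀ b → ¬ T b → T (not b)
T-not⁺ false _  = _
T-not⁺ true  ¬t = ¬t _

T-not⁻ : ∀ b → T (not b) → ¬ T b
T-not⁻ false _ ()

not-both⁺ : ∀ a b → (T a → T b → ⊥) → T (not a ∨ not b)
not-both⁺ false _     _ = _
not-both⁺ true  false _ = _
not-both⁺ true  true  h = h _ _

not-both⁻ : ∀ a b → T (not a ∨ not b) → T a → T b → ⊥
not-both⁻ true true () _ _

T-∧⁴⁺ : ∀ a b c d → T a → T b → T c → T d → T (a ∧ b ∧ c ∧ d)
T-∧⁴⁺ true true true true _ _ _ _ = _

T-∧⁴⁻ : ∀ a b c d → T (a ∧ b ∧ c ∧ d) → T a × T b × T c × T d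
T-∧⁴⁻ true true true true _ = _ , _ , _ , _

-- Permutations of {0, …, n-1} as functions on ℕ

Bounded : ℕ → (ℕ → ℕ) → Set
Bounded n f = ∀ i → i < n → f i < n

InjectiveBelow : ℕ → (ℕ → ℕ) → Set
InjectiveBelow n f = ∀ i j → i < n → j < n → f i ≡ f j → i ≡ j

Avoids321 : ℕ → (ℕ → ℕ) → Set
Avoids321 n f = ∀ i j k → i < j → j < k → k < n → f j < f i → f k < f j → ⊥

AtMostOneCrossing : ℕ → (ℕ → ℕ) → Set
AtMostOneCrossing n f = ∀ a i j → a ≤ n → i < a → j < a → a ≤ f i → a ≤ f j → i ≡ j

-- π = π^rci says exactly that i ↦ (n - 1) - π i is an involution.
Persymmetric : ℕ → (ℕ → ℕ) → Set
Persymmetric n f = ∀ i → i < n → (n ∸ 1) ∸ f ((n ∸ 1) ∸ f i) ≡ i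

-- Shallowness enters in the equivalent form AtMostOneCrossing, see shallow⇔oneCrossing.
record IsGood (n : ℕ) (f : ℕ → ℕ) : Set where
  field
    bounded      : Bounded n f
    injective    : InjectiveBelow n f
    avoiding     : Avoids321 n f
    persym       : Persymmetric n f
    oneCrossing  : AtMostOneCrossing n f

IsGood-cong : ∀ {n f g} → IsGood n f → (∀ i → i < n → f i ≡ g i) → IsGood n g
IsGood-cong {n} {f} {g} f-good f≡g = record
  { bounded     = λ i i<n → subst (_< n) (f≡g i i<n) (bounded i i<n)
  ; injective   = λ i j i<n j<n gi≡gj →
      injective i j i<n j<n (trans (f≡g i i<n) (trans gi≡gj (sym (f≡g j j<n))))
  ; avoiding    = λ i j k i<j j<k k<n gj<gi gk<gj →
      avoiding i j k i<j j<k k<n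
        (subst₂ _<_ (sym (f≡g j (<-trans j<k k<n))) (sym (f≡g i (<-trans i<j (<-trans j<k k<n)))) gj<gi)
        (subst₂ _<_ (sym (f≡g k k<n)) (sym (f≡g j (<-trans j<k k<n))) gk<gj)
  ; persym      = λ i i<n → trans (cong (λ y → (n ∸ 1) ∸ y)
                    (trans (sym (f≡g _ (m∸1∸x<m n (g i) (≤-<-trans z≤n i<n))))
                           (cong (λ y → f ((n ∸ 1) ∸ y)) (sym (f≡g i i<n)))))
                    (persym i i<n)
  ; oneCrossing = λ a i j a≤n i<a j<a a≤gi a≤gj → oneCrossing a i j a≤n i<a j<a
                    (subst (a ≤_) (sym (f≡g i (<-≤-trans i<a a≤n))) a≤gi)
                    (subst (a ≤_) (sym (f≡g j (<-≤-trans j<a a≤n))) a≤gj)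
  }
  where open IsGood f-good

iterate : (ℕ → ℕ) → ℕ → ℕ → ℕ
iterate f zero    a = a
iterate f (suc k) a = f (iterate f k a)

isCycleMin : ℕ → (ℕ → ℕ) → ℕ → Bool
isCycleMin n f a = all (λ k → not (iterate f (suc k) a <ᵇ a)) (upTo n)

isCycleMin⁺ : ∀ n f a → (∀ k → k < n → a ≤ iterate f (suc k) a) → T (isCycleMin n f a)
isCycleMin⁺ n f a above = all⁻ _ (All.tabulate (λ {k} k∈ →
  T-not⁺ (iterate f (suc k) a <ᵇ a) (≤⇒≯ (above k (∈-upTo⁻ k∈)) ∘ <ᵇ⇒< _ a)))

isCycleMin⁻ : ∀ n f a → T (isCycleMin n f a) → ∀ k → k < n → a ≤ iterate f (suc k) a
isCycleMin⁻ n f a isMin k k<n =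
  ≮⇒≥ (T-not⁻ (iterate f (suc k) a <ᵇ a) (All.lookup (all⁺ _ (upTo n) isMin) (∈-upTo⁺ k<n))
       ∘ <⇒<ᵇ)

module Statistics (n : ℕ) (f : ℕ → ℕ) where

  rightInversions : ℕ → ℕ
  rightInversions i = count< n (λ j → (i <? j) ×-dec (f j <? f i))

  leftInversions : ℕ → ℕ
  leftInversions i = count< n (λ j → (j <? i) ×-dec (f i <? f j))

  upCrossings : ℕ → ℕ
  upCrossings a = count< n (λ j → (j <? a) ×-dec (a ≤? f j))

  downCrossings : ℕ → ℕ
  downCrossings a = count< n (λ j → (a ≤? j) ×-dec (f j <? a))

  totalCrossings : ℕ
  totalCrossings = sum< n upCrossings

  cycleMinima : ℕ
  cycleMinima = count< n (λ a → T? (isCycleMin n f a))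

  uncrossedCuts : ℕ
  uncrossedCuts = count< n (λ a → upCrossings a ≟ 0)

module Permutation {n : ℕ} {f : ℕ → ℕ} (bounded : Bounded n f) (injective : InjectiveBelow n f) where

  open Statistics n f public

  count-values-below : ∀ x → x ≤ n → count< n (λ j → f j <? x) ≡ x
  count-values-below x x≤n = ≤-antisym atMost atLeast
    where
    open ≤-Reasoning
    below? : ∀ j → Dec (f j < x)
    below? j = f j <? x
    notBelow? : ∀ j → Dec (¬ f j < x)
    notBelow? j = ¬? (below? j)
    atMost : count< n below? ≤ x
    atMost = count<-injection _ x n f (λ _ _ fj<x → fj<x) (λ i j i<n j<n _ _ → injective i j i<n j<n)
    rest : count< n notBelow? ≤ n ∸ x
    rest = count<-injection _ (n ∸ x) n (λ j → f j ∸ x)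
             (λ j j<n fj≮x → ∸-monoˡ-< (bounded j j<n) (≮⇒≥ fj≮x))
             (λ i j i<n j<n fi≮x fj≮x eq →
               injective i j i<n j<n (∸-cancelʳ-≡ (≮⇒≥ fi≮x) (≮⇒≥ fj≮x) eq))
    atLeast : x ≤ count< n below?
    atLeast = begin
      x                                                   ≡⟨ m∸[m∸n]≡n x≤n ⟨
      n ∸ (n ∸ x)                                         ≤⟨ ∸-monoʳ-≤ n rest ⟩
      n ∸ count< n notBelow?
        ≡⟨ cong (_∸ count< n notBelow?) (count<-complement below? n) ⟨
      count< n below? + count< n notBelow? ∸ count< n notBelow?  ≡⟨ m+n∸n≡m _ (count< n notBelow?) ⟩
      count< n below?                                     ∎

  surjective : ∀ a → a < n → ∃[ z ] (z < n × f z ≡ a)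
  surjective a a<n with count<-witness hit n (≤-reflexive (sym hits))
    where
    open ≡-Reasoning
    hit : ∀ j → Dec (f j < suc a × ¬ f j < a)
    hit j = (f j <? suc a) ×-dec ¬? (f j <? a)
    below : count< n (λ j → (f j <? suc a) ×-dec (f j <? a)) ≡ a
    below = trans (count<-cong n (λ _ _ → proj₂) (λ _ _ fj<a → m<n⇒m<1+n fj<a , fj<a))
                  (count-values-below a (<⇒≤ a<n))
    hits : count< n hit ≡ 1
    hits = +-cancelˡ-≡ a _ _ (begin
      a + count< n hit                          ≡⟨ cong (_+ count< n hit) below ⟨
      count< n (λ j → (f j <? suc a) ×-dec (f j <? a)) + count< n hit
                                                ≡⟨ count<-split (λ j → f j <? suc a) (λ j → f j <? a) n ⟨
      count< n (λ j → f j <? suc a)             ≡⟨ count-values-below (suc a) a<n ⟩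
      suc a                                     ≡⟨ +-comm 1 a ⟩
      a + 1                                     ∎)
  ... | z , z<n , (fz<1+a , fz≮a) = z , z<n , ≤-antisym (≤-pred fz<1+a) (≮⇒≥ fz≮a)

  value+leftInversions≡index+rightInversions :
    ∀ i → i < n → f i + leftInversions i ≡ i + rightInversions i
  value+leftInversions≡index+rightInversions i i<n = begin
    f i + leftInversions i                          ≡⟨ cong (_+ leftInversions i) value ⟩
    smaller + rightInversions i + leftInversions i  ≡⟨ xy∙z≈xz∙y smaller _ _ ⟩
    smaller + leftInversions i + rightInversions i  ≡⟨ cong (_+ rightInversions i) index ⟨
    i + rightInversions i                           ∎
    where
    open ≡-Reasoning
    smaller : ℕ
    smaller = count< n (λ j → (j <? i) ×-dec (f j <? f i))
    value : f i ≡ smaller + rightInversions i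
    value = begin
      f i                                 ≡⟨ count-values-below (f i) (<⇒≤ (bounded i i<n)) ⟨
      count< n (λ j → f j <? f i)         ≡⟨ count<-split (λ j → f j <? f i) (_<? i) n ⟩
      count< n (λ j → (f j <? f i) ×-dec (j <? i)) + count< n (λ j → (f j <? f i) ×-dec ¬? (j <? i))
        ≡⟨ cong₂ _+_ (count<-cong n (λ _ _ → swap) (λ _ _ → swap))
                     (count<-cong n (λ j _ (fj<fi , j≮i) →
                                      ≤∧≢⇒< (≮⇒≥ j≮i) (λ i≡j → <-irrefl (cong f (sym i≡j)) fj<fi) , fj<fi)
                                    (λ _ _ (i<j , fj<fi) → fj<fi , <-asym i<j)) ⟩
      smaller + rightInversions i         ∎
    index : i ≡ smaller + leftInversions i
    index = begin
      i                                   ≡⟨ count<-< n i (<⇒≤ i<n) ⟨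
      count< n (_<? i)                    ≡⟨ count<-split (_<? i) (λ j → f j <? f i) n ⟩
      smaller + count< n (λ j → (j <? i) ×-dec ¬? (f j <? f i))
        ≡⟨ cong (smaller +_) (count<-cong n
             (λ j j<n (j<i , fj≮fi) →
               j<i , ≤∧≢⇒< (≮⇒≥ fj≮fi) (λ fi≡fj → <-irrefl (injective j i j<n i<n (sym fi≡fj)) j<i))
             (λ _ _ (j<i , fi<fj) → j<i , <-asym fi<fj)) ⟩
      smaller + leftInversions i          ∎

  crossings-balance : ∀ a → a ≤ n → upCrossings a ≡ downCrossings a
  crossings-balance a a≤n = +-cancelˡ-≡ stay _ _ (trans (sym byIndex) byValue)
    where
    stay : ℕ
    stay = count< n (λ j → (j <? a) ×-dec (f j <? a))
    byIndex : a ≡ stay + upCrossings a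
    byIndex = trans (sym (count<-< n a a≤n))
      (trans (count<-split (_<? a) (λ j → f j <? a) n)
        (cong (stay +_) (count<-cong n (λ _ _ (j<a , fj≮a) → j<a , ≮⇒≥ fj≮a)
                                       (λ _ _ (j<a , a≤fj) → j<a , ≤⇒≯ a≤fj))))
    byValue : a ≡ stay + downCrossings a
    byValue = trans (sym (count-values-below a a≤n))
      (trans (count<-split (λ j → f j <? a) (_<? a) n)
        (cong₂ _+_ (count<-cong n (λ _ _ → swap) (λ _ _ → swap))
                   (count<-cong n (λ _ _ (fj<a , j≮a) → ≮⇒≥ j≮a , fj<a)
                                  (λ _ _ (a≤j , fj<a) → fj<a , ≤⇒≯ a≤j))))

  -- Both sides count the pairs (j, a) with j < a ≤ f j.
  sum-excedances : sum< n (λ j → f j ∸ j) ≡ totalCrossings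
  sum-excedances = begin
    sum< n (λ j → f j ∸ j)
      ≡⟨ sum<-cong n (λ j j<n → count<-interval n j (f j) (bounded j j<n)) ⟨
    sum< n (λ j → count< n (λ a → (j <? a) ×-dec (a ≤? f j)))
      ≡⟨ sum<-cong n (λ j _ → count<≡sum< _ n) ⟩
    sum< n (λ j → sum< n (λ a → indicator ((j <? a) ×-dec (a ≤? f j))))
      ≡⟨ sum<-comm n n (λ j a → indicator ((j <? a) ×-dec (a ≤? f j))) ⟩
    sum< n (λ a → sum< n (λ j → indicator ((j <? a) ×-dec (a ≤? f j))))
      ≡⟨ sum<-cong n (λ a _ → count<≡sum< _ n) ⟨
    totalCrossings ∎
    where open ≡-Reasoning

  sum-deficiencies : sum< n (λ j → j ∸ f j) ≡ totalCrossings
  sum-deficiencies = begin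
    sum< n (λ j → j ∸ f j)
      ≡⟨ sum<-cong n (λ j j<n → count<-interval n (f j) j j<n) ⟨
    sum< n (λ j → count< n (λ a → (f j <? a) ×-dec (a ≤? j)))
      ≡⟨ sum<-cong n (λ j _ → count<≡sum< _ n) ⟩
    sum< n (λ j → sum< n (λ a → indicator ((f j <? a) ×-dec (a ≤? j))))
      ≡⟨ sum<-comm n n (λ j a → indicator ((f j <? a) ×-dec (a ≤? j))) ⟩
    sum< n (λ a → sum< n (λ j → indicator ((f j <? a) ×-dec (a ≤? j))))
      ≡⟨ sum<-cong n (λ a a<n → trans (sym (count<≡sum< (λ j → (f j <? a) ×-dec (a ≤? j)) n))
           (trans (count<-cong n (λ _ _ → swap) (λ _ _ → swap)) (sym (crossings-balance a (<⇒≤ a<n))))) ⟩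
    totalCrossings ∎
    where open ≡-Reasoning

  sum-displacements : sum< n (λ j → ∣ f j - j ∣) ≡ totalCrossings + totalCrossings
  sum-displacements =
    trans (sum<-cong n (λ j _ → ∣-∣≡∸+∸ (f j) j))
      (trans (sum<-+ n (λ j → f j ∸ j) (λ j → j ∸ f j))
        (cong₂ _+_ sum-excedances sum-deficiencies))

  module _ (avoids : Avoids321 n f) where

    inversions-one-sided : ∀ i → rightInversions i ≡ 0 ⊎ leftInversions i ≡ 0
    inversions-one-sided i with rightInversions i in r | leftInversions i in l
    ... | zero  | _     = inj₁ refl
    ... | suc _ | zero  = inj₂ refl
    ... | suc _ | suc _
      with count<-witness (λ k → (i <? k) ×-dec (f k <? f i)) n (subst (1 ≤_) (sym r) (s≤s z≤n))
         | count<-witness (λ j → (j <? i) ×-dec (f i <? f j)) n (subst (1 ≤_) (sym l) (s≤s z≤n))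
    ...   | k , k<n , (i<k , fk<fi) | j , _ , (j<i , fi<fj) = ⊥-elim (avoids j i k j<i i<k k<n fi<fj fk<fi)

    rightInversions≡excedance : ∀ i → i < n → rightInversions i ≡ f i ∸ i
    rightInversions≡excedance i i<n with inversions-one-sided i
    ... | inj₁ r≡0 =
      trans r≡0 (sym (m≤n⇒m∸n≡0 (subst (f i ≤_) i+r≡i (m≤m+n (f i) (leftInversions i)))))
      where
      i+r≡i : f i + leftInversions i ≡ i
      i+r≡i = trans (value+leftInversions≡index+rightInversions i i<n) (trans (cong (i +_) r≡0) (+-identityʳ i))
    ... | inj₂ l≡0 = sym (trans (cong (_∸ i) fi≡i+r) (m+n∸m≡n i (rightInversions i)))
      where
      fi≡i+r : f i ≡ i + rightInversions i
      fi≡i+r = trans (sym (trans (cong (f i +_) l≡0) (+-identityʳ (f i))))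
                     (value+leftInversions≡index+rightInversions i i<n)

    sum-rightInversions : sum< n rightInversions ≡ totalCrossings
    sum-rightInversions = trans (sum<-cong n rightInversions≡excedance) sum-excedances

  iterate-bounded : ∀ k a → a < n → iterate f k a < n
  iterate-bounded zero    a a<n = a<n
  iterate-bounded (suc k) a a<n = bounded _ (iterate-bounded k a a<n)

  iterate-cancel : ∀ a → a < n → ∀ i k → iterate f (i + k) a ≡ iterate f i a → iterate f k a ≡ a
  iterate-cancel a a<n zero    k eq = eq
  iterate-cancel a a<n (suc i) k eq =
    iterate-cancel a a<n i k (injective _ _ (iterate-bounded (i + k) a a<n) (iterate-bounded i a a<n) eq)

  period : ∀ a → a < n → ∃[ p ] (1 ≤ p × p ≤ n × iterate f p a ≡ a)
  period a a<n with pigeonhole (n<1+n n) orbit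
    where
    orbit : Fin (suc n) → Fin n
    orbit t = fromℕ< (iterate-bounded (toℕ t) a a<n)
  ... | i , j , i<j , same =
    toℕ j ∸ toℕ i , m<n⇒0<n∸m i<j , ≤-trans (m∸n≤m (toℕ j) (toℕ i)) (≤-pred (toℕ<n j)) ,
    iterate-cancel a a<n (toℕ i) (toℕ j ∸ toℕ i)
      (trans (cong (λ q → iterate f q a) (m+[n∸m]≡n (<⇒≤ i<j)))
             (trans (sym (toℕ-fromℕ< _)) (trans (cong toℕ (sym same)) (toℕ-fromℕ< _))))

  preimage-on-orbit : ∀ a → a < n → ∃[ t ] (t < n × f (iterate f t a) ≡ a)
  preimage-on-orbit a a<n with period a a<n
  ... | suc t , _ , p≤n , returns = t , p≤n , returns

  stays-above : ∀ a → a ≤ n → upCrossings a ≡ 0 → ∀ x → x < n → a ≤ x → a ≤ f x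
  stays-above a a≤n up≡0 x x<n a≤x with f x <? a
  ... | no  fx≮a = ≮⇒≥ fx≮a
  ... | yes fx<a = contradiction (trans (sym (crossings-balance a a≤n)) up≡0)
                                 (>⇒≢ (count<-≥1 _ n x x<n (a≤x , fx<a)))

  uncrossed⇒isCycleMin : ∀ a → upCrossings a ≡ 0 → a < n → T (isCycleMin n f a)
  uncrossed⇒isCycleMin a up≡0 a<n = isCycleMin⁺ n f a (λ k _ → above (suc k))
    where
    above : ∀ k → a ≤ iterate f k a
    above zero    = ≤-refl
    above (suc k) = stays-above a (<⇒≤ a<n) up≡0 _ (iterate-bounded k a a<n) (above k)

  module _ (avoids : Avoids321 n f) (oneCrossing : AtMostOneCrossing n f) where

    -- If f a = a, arcs j < a ≤ f j and x > a > f x form the 321 (j, a, x).  Otherwise the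
    -- predecessor z of a on its cycle lies below a: for z > a the cut a + 1 would be crossed
    -- by both j and a.
    crossed⇒descends : ∀ a → a < n → 1 ≤ upCrossings a → ∃[ t ] (t < n × iterate f (suc t) a < a)
    crossed⇒descends a a<n 1≤up with count<-witness _ n 1≤up
    ... | j , j<n , (j<a , a≤fj) with <-cmp (f a) a
    ...   | tri< fa<a _ _ = 0 , ≤-trans (s≤s z≤n) a<n , fa<a
    ...   | tri≈ _ fa≡a _ with count<-witness _ n (subst (1 ≤_) (crossings-balance a (<⇒≤ a<n)) 1≤up)
    ...     | x , x<n , (a≤x , fx<a) = ⊥-elim (avoids j a x j<a a<x x<n fa<fj fx<fa)
      where
      fa<fj : f a < f j
      fa<fj = subst (_< f j) (sym fa≡a)
                (≤∧≢⇒< a≤fj (λ a≡fj → <-irrefl (injective j a j<n a<n (trans (sym a≡fj) (sym fa≡a))) j<a))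
      fx<fa : f x < f a
      fx<fa = subst (f x <_) (sym fa≡a) fx<a
      a<x : a < x
      a<x = ≤∧≢⇒< a≤x (λ a≡x → <-irrefl (trans (cong f (sym a≡x)) fa≡a) fx<a)
    crossed⇒descends a a<n 1≤up | j , j<n , (j<a , a≤fj) | tri> _ _ a<fa with preimage-on-orbit a a<n
    ... | zero  , _ , fa≡a = ⊥-elim (<-irrefl (sym fa≡a) a<fa)
    ... | suc t , 1+t<n , fz≡a with <-cmp (iterate f (suc t) a) a
    ...   | tri< z<a _ _ = t , <-trans (n<1+n t) 1+t<n , z<a
    ...   | tri≈ _ z≡a _ = ⊥-elim (<-irrefl (trans (sym fz≡a) (cong f z≡a)) a<fa)
    ...   | tri> _ _ a<z = ⊥-elim (<-irrefl (oneCrossing (suc a) j a a<n (m<n⇒m<1+n j<a) ≤-refl a<fj a<fa) j<a)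
      where
      a<fj : a < f j
      a<fj = ≤∧≢⇒< a≤fj (λ a≡fj → <-irrefl
               (injective j _ j<n (iterate-bounded (suc t) a a<n) (trans (sym a≡fj) (sym fz≡a))) (<-trans j<a a<z))

    crossed⇒¬isCycleMin : ∀ a → a < n → 1 ≤ upCrossings a → ¬ T (isCycleMin n f a)
    crossed⇒¬isCycleMin a a<n 1≤up isMin with crossed⇒descends a a<n 1≤up
    ... | t , t<n , descends = <⇒≱ descends (isCycleMin⁻ n f a isMin t t<n)

  uncrossedCuts≤cycleMinima : uncrossedCuts ≤ cycleMinima
  uncrossedCuts≤cycleMinima = count<-mono n (λ a a<n up≡0 → uncrossed⇒isCycleMin a up≡0 a<n)

  uncrossedCuts≡cycleMinima : Avoids321 n f → AtMostOneCrossing n f → uncrossedCuts ≡ cycleMinima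
  uncrossedCuts≡cycleMinima avoids oneCrossing = count<-cong n
    (λ a a<n up≡0 → uncrossed⇒isCycleMin a up≡0 a<n)
    (λ a a<n isMin →
      n≤0⇒n≡0 (≮⇒≥ (λ 0<up → crossed⇒¬isCycleMin avoids oneCrossing a a<n 0<up isMin)))

  crossings+uncrossedCuts :
    totalCrossings + uncrossedCuts ≡ sum< n (λ a → upCrossings a + indicator (upCrossings a ≟ 0))
  crossings+uncrossedCuts =
    sym (trans (sum<-+ n upCrossings (λ a → indicator (upCrossings a ≟ 0)))
               (cong (totalCrossings +_) (sym (count<≡sum< _ n))))

  cutWeight≥1 : ∀ a → 1 ≤ upCrossings a + indicator (upCrossings a ≟ 0)
  cutWeight≥1 a with upCrossings a
  ... | zero  = ≤-refl
  ... | suc _ = s≤s z≤n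

  oneCrossing⇒crossings+uncrossedCuts≡n : AtMostOneCrossing n f → totalCrossings + uncrossedCuts ≡ n
  oneCrossing⇒crossings+uncrossedCuts≡n oneCrossing =
    trans crossings+uncrossedCuts (trans (sum<-cong n weight≡1) (sum<-ones n))
    where
    weight≡1 : ∀ a → a < n → upCrossings a + indicator (upCrossings a ≟ 0) ≡ 1
    weight≡1 a a<n
      with upCrossings a
         | count<-≤1 (λ j → (j <? a) ×-dec (a ≤? f j)) n
             (λ i j _ _ (i<a , a≤fi) (j<a , a≤fj) → oneCrossing a i j (<⇒≤ a<n) i<a j<a a≤fi a≤fj)
    ... | zero        | _ = refl
    ... | suc zero    | _ = refl
    ... | suc (suc _) | s≤s ()

  crossings+uncrossedCuts≤n⇒oneCrossing : totalCrossings + uncrossedCuts ≤ n → AtMostOneCrossing n f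
  crossings+uncrossedCuts≤n⇒oneCrossing ≤n a i j a≤n i<a j<a a≤fi a≤fj with i ≟ j
  ... | yes i≡j = i≡j
  ... | no  i≢j = contradiction ≤n (<⇒≱ (subst (n <_) (sym crossings+uncrossedCuts)
          (sum<-positive-strict n (λ a _ → cutWeight≥1 a) a a<n
            (≤-trans (count<-≥2 _ n i j (<-≤-trans i<a a≤n) (<-≤-trans j<a a≤n) i≢j
                                (i<a , a≤fi) (j<a , a≤fj))
                     (m≤m+n _ _)))))
    where
    a<n : a < n
    a<n = ≤-<-trans a≤fi (bounded i (<-≤-trans i<a a≤n))

  shallow⇔oneCrossing : Avoids321 n f →
    (sum< n rightInversions + (n ∸ cycleMinima) ≡ sum< n (λ j → ∣ f j - j ∣)) ⇔ AtMostOneCrossing n f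
  shallow⇔oneCrossing avoids = mk⇔ ⇒ ⇐
    where
    ⇐ : AtMostOneCrossing n f → sum< n rightInversions + (n ∸ cycleMinima) ≡ sum< n (λ j → ∣ f j - j ∣)
    ⇐ oneCrossing = begin
      sum< n rightInversions + (n ∸ cycleMinima)  ≡⟨ cong₂ (λ r c → r + (n ∸ c)) (sum-rightInversions avoids)
                                                      (sym (uncrossedCuts≡cycleMinima avoids oneCrossing)) ⟩
      totalCrossings + (n ∸ uncrossedCuts)        ≡⟨ cong (λ m → totalCrossings + (m ∸ uncrossedCuts))
                                                      (oneCrossing⇒crossings+uncrossedCuts≡n oneCrossing) ⟨
      totalCrossings + (totalCrossings + uncrossedCuts ∸ uncrossedCuts)
                                                  ≡⟨ cong (totalCrossings +_) (m+n∸n≡m totalCrossings uncrossedCuts) ⟩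
      totalCrossings + totalCrossings             ≡⟨ sum-displacements ⟨
      sum< n (λ j → ∣ f j - j ∣)                  ∎
      where open ≡-Reasoning
    ⇒ : sum< n rightInversions + (n ∸ cycleMinima) ≡ sum< n (λ j → ∣ f j - j ∣) → AtMostOneCrossing n f
    ⇒ shallow = crossings+uncrossedCuts≤n⇒oneCrossing (begin
      totalCrossings + uncrossedCuts      ≡⟨ cong (_+ uncrossedCuts) transpositions ⟨
      n ∸ cycleMinima + uncrossedCuts     ≤⟨ +-monoʳ-≤ (n ∸ cycleMinima) uncrossedCuts≤cycleMinima ⟩
      n ∸ cycleMinima + cycleMinima       ≡⟨ m∸n+n≡m (count<-≤ _ n) ⟩
      n                                   ∎)
      where
      open ≤-Reasoning
      transpositions : n ∸ cycleMinima ≡ totalCrossings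
      transpositions = +-cancelˡ-≡ totalCrossings _ _
        (trans (cong (_+ (n ∸ cycleMinima)) (sym (sum-rightInversions avoids)))
               (trans shallow sum-displacements))

fun : ∀ {k m} → Vec (Fin k) m → ℕ → ℕ
fun []      _       = 0
fun (x ∷ v) zero    = toℕ x
fun (x ∷ v) (suc i) = fun v i

fun-lookup : ∀ {k m} (v : Vec (Fin k) m) i → fun v (toℕ i) ≡ toℕ (lookup v i)
fun-lookup (x ∷ v) fzero    = refl
fun-lookup (x ∷ v) (fsuc i) = fun-lookup v i

fun-bounded : ∀ {k m} (v : Vec (Fin k) m) i → i < m → fun v i < k
fun-bounded (x ∷ v) zero    _         = toℕ<n x
fun-bounded (x ∷ v) (suc i) (s≤s i<m) = fun-bounded v i i<m

toℕ-surjective< : ∀ {n i} → i < n → ∃[ i' ] (toℕ {n} i' ≡ i)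
toℕ-surjective< i<n = fromℕ< i<n , toℕ-fromℕ< i<n

toVec : ∀ {n} (f : ℕ → ℕ) → Bounded n f → Vec (Fin n) n
toVec f bounded = Vec.tabulate (λ i → fromℕ< (bounded (toℕ i) (toℕ<n i)))

fun-toVec : ∀ {n} f (bounded : Bounded n f) i → i < n → fun (toVec f bounded) i ≡ f i
fun-toVec f bounded i i<n with toℕ-surjective< i<n
... | i' , refl = trans (fun-lookup (toVec f bounded) i')
                        (trans (cong toℕ (lookup∘tabulate (λ j → fromℕ< (bounded (toℕ j) (toℕ<n j))) i'))
                               (toℕ-fromℕ< _))

fun-injective : ∀ {k m} (v w : Vec (Fin k) m) → (∀ i → i < m → fun v i ≡ fun w i) → v ≡ w
fun-injective []      []      _     = refl
fun-injective (x ∷ v) (y ∷ w) v≡w =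
  cong₂ _∷_ (toℕ-injective (v≡w 0 z<s)) (fun-injective v w (λ i i<m → v≡w (suc i) (s≤s i<m)))

∀Fin⇒∀< : ∀ {n} {P : ℕ → Set} → (∀ (i : Fin n) → P (toℕ i)) → ∀ i → i < n → P i
∀Fin⇒∀< {P = P} all-P i i<n = subst P (toℕ-fromℕ< i<n) (all-P (fromℕ< i<n))

all-allFin⁺ : ∀ {n} (p : Fin n → Bool) → (∀ i → T (p i)) → T (all p (allFin n))
all-allFin⁺ {n} p all-p = all⁻ p {allFin n} (All.tabulate (λ {i} _ → all-p i))

all-allFin⁻ : ∀ {n} (p : Fin n → Bool) → T (all p (allFin n)) → ∀ i → T (p i)
all-allFin⁻ {n} p t i = All.lookup (all⁺ p (allFin n) t) (∈-allFin i)

any-allFin⁺ : ∀ {n} (p : Fin n → Bool) i → T (p i) → T (any p (allFin n))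
any-allFin⁺ p i t = any⁺ p (Any.map (λ { refl → t }) (∈-allFin i))

any-allFin⁻ : ∀ {n} (p : Fin n → Bool) → T (any p (allFin n)) → ∃[ i ] T (p i)
any-allFin⁻ {n} p t with find (any⁻ p (allFin n) t)
... | i , _ , pi = i , pi

sum-map-tabulate : ∀ n {A : Set} (g : Fin n → A) (h : A → ℕ) (h' : ℕ → ℕ) →
                   (∀ i → h (g i) ≡ h' (toℕ i)) → sum (map h (tabulate g)) ≡ sum< n h'
sum-map-tabulate zero    g h h' eq = refl
sum-map-tabulate (suc n) g h h' eq =
  trans (cong₂ _+_ (eq fzero) (sum-map-tabulate n (g ∘ fsuc) h (h' ∘ suc) (eq ∘ fsuc)))
        (sym (sum<-front n h'))

length-filter≡sum : ∀ {A : Set} {P : A → Set} (P? : Decidable P) xs →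
                    length (filter P? xs) ≡ sum (map (λ x → indicator (P? x)) xs)
length-filter≡sum P? []       = refl
length-filter≡sum P? (x ∷ xs) with P? x
... | yes _ = cong suc (length-filter≡sum P? xs)
... | no  _ = length-filter≡sum P? xs

module _ {n : ℕ} (v : Vec (Fin n) n) where

  π≡fun : ∀ i → π v i ≡ fun v (toℕ i)
  π≡fun i = sym (fun-lookup v i)

  isPerm⇒distinct : T (isPerm v) → ∀ i j → toℕ i < toℕ j → fun v (toℕ i) ≢ fun v (toℕ j)
  isPerm⇒distinct t i j i<j fi≡fj =
    not-both⁻ _ (π v i ≡ᵇ π v j) (all-allFin⁻ _ (all-allFin⁻ _ t i) j) (<⇒<ᵇ i<j)
              (≡⇒≡ᵇ _ _ (trans (π≡fun i) (trans fi≡fj (sym (π≡fun j)))))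

  isPerm⇔injective : T (isPerm v) ⇔ InjectiveBelow n (fun v)
  isPerm⇔injective = mk⇔ ⇒ ⇐
    where
    ⇒ : T (isPerm v) → InjectiveBelow n (fun v)
    ⇒ t i j i<n j<n fi≡fj with toℕ-surjective< i<n | toℕ-surjective< j<n
    ... | i' , refl | j' , refl with <-cmp (toℕ i') (toℕ j')
    ...   | tri< i<j _ _ = contradiction fi≡fj (isPerm⇒distinct t i' j' i<j)
    ...   | tri≈ _ i≡j _ = i≡j
    ...   | tri> _ _ j<i = contradiction (sym fi≡fj) (isPerm⇒distinct t j' i' j<i)
    ⇐ : InjectiveBelow n (fun v) → T (isPerm v)
    ⇐ injective = all-allFin⁺ _ (λ i → all-allFin⁺ _ (λ j →
      not-both⁺ (toℕ i <ᵇ toℕ j) (π v i ≡ᵇ π v j) (λ i<j πi≡πj →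
        <-irrefl (injective (toℕ i) (toℕ j) (toℕ<n i) (toℕ<n j)
                   (trans (sym (π≡fun i)) (trans (≡ᵇ⇒≡ _ _ πi≡πj) (π≡fun j))))
                 (<ᵇ⇒< _ _ i<j))))

  avoids321⇔Avoids321 : T (avoids321 v) ⇔ Avoids321 n (fun v)
  avoids321⇔Avoids321 = mk⇔ ⇒ ⇐
    where
    ⇒ : T (avoids321 v) → Avoids321 n (fun v)
    ⇒ t i j k i<j j<k k<n fj<fi fk<fj
      with toℕ-surjective< (<-trans i<j (<-trans j<k k<n)) | toℕ-surjective< (<-trans j<k k<n)
         | toℕ-surjective< k<n
    ... | i' , refl | j' , refl | k' , refl =
      T-not⁻ _ t (any-allFin⁺ _ i' (any-allFin⁺ _ j' (any-allFin⁺ _ k'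
        (T-∧⁴⁺ (toℕ i' <ᵇ toℕ j') (toℕ j' <ᵇ toℕ k') (π v j' <ᵇ π v i') (π v k' <ᵇ π v j')
               (<⇒<ᵇ i<j) (<⇒<ᵇ j<k)
               (<⇒<ᵇ (subst₂ _<_ (sym (π≡fun j')) (sym (π≡fun i')) fj<fi))
               (<⇒<ᵇ (subst₂ _<_ (sym (π≡fun k')) (sym (π≡fun j')) fk<fj))))))
    ⇐ : Avoids321 n (fun v) → T (avoids321 v)
    ⇐ avoids = T-not⁺ _ λ t →
      let i , ti = any-allFin⁻ _ t
          j , tj = any-allFin⁻ _ ti
          k , tk = any-allFin⁻ _ tj
          i<j , j<k , πj<πi , πk<πj =
            T-∧⁴⁻ (toℕ i <ᵇ toℕ j) (toℕ j <ᵇ toℕ k) (π v j <ᵇ π v i) (π v k <ᵇ π v j) tk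
      in avoids (toℕ i) (toℕ j) (toℕ k) (<ᵇ⇒< _ _ i<j) (<ᵇ⇒< _ _ j<k) (toℕ<n k)
           (subst₂ _<_ (π≡fun j) (π≡fun i) (<ᵇ⇒< _ _ πj<πi))
           (subst₂ _<_ (π≡fun k) (π≡fun j) (<ᵇ⇒< _ _ πk<πj))

  rc≡ : ∀ i → rc v (lookup v i) ≡ (n ∸ 1) ∸ fun v ((n ∸ 1) ∸ fun v (toℕ i))
  rc≡ i = cong ((n ∸ 1) ∸_) (trans (π≡fun (opposite (lookup v i)))
            (cong (fun v) (trans (opposite-prop (lookup v i))
              (trans (sym (∸-+-assoc n 1 _)) (cong ((n ∸ 1) ∸_) (sym (fun-lookup v i)))))))

  persymmetric⇔Persymmetric : T (persymmetric v) ⇔ Persymmetric n (fun v)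
  persymmetric⇔Persymmetric = mk⇔
    (λ t → ∀Fin⇒∀< (λ i → trans (sym (rc≡ i)) (≡ᵇ⇒≡ _ _ (all-allFin⁻ _ t i))))
    (λ persym → all-allFin⁺ _ (λ i → ≡⇒≡ᵇ _ _ (trans (rc≡ i) (persym (toℕ i) (toℕ<n i)))))

  open Statistics n (fun v)

  Dis≡ : Dis v ≡ sum< n (λ j → ∣ fun v j - j ∣)
  Dis≡ = sum-map-tabulate n id _ _ (λ i → cong (∣_- toℕ i ∣) (π≡fun i))

  Inv≡ : Inv v ≡ sum< n rightInversions
  Inv≡ = sum-map-tabulate n id _ _ (λ i →
    trans (length-filter≡sum _ (allFin n))
      (trans (sum-map-tabulate n id _ _ (λ j →
                cong₂ (λ a b → indicator ((toℕ i <? toℕ j) ×-dec (a <? b))) (π≡fun j) (π≡fun i)))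
             (sym (count<≡sum< _ n))))

  iter≡iterate : ∀ k i → toℕ (iter v k i) ≡ iterate (fun v) k (toℕ i)
  iter≡iterate zero    i = refl
  iter≡iterate (suc k) i = trans (sym (fun-lookup v (iter v k i))) (cong (fun v) (iter≡iterate k i))

  cyc≡ : cyc v ≡ cycleMinima
  cyc≡ = trans (length-filter≡sum _ (allFin n))
    (trans (sum-map-tabulate n id _ _ (λ i → cong (indicator ∘ T?)
              (cong and (map-cong (λ k → cong (λ q → not (q <ᵇ toℕ i)) (iter≡iterate (suc k) i)) (upTo n)))))
           (sym (count<≡sum< _ n)))

  shallow⇔ : T (shallow v) ⇔
             (sum< n rightInversions + (n ∸ cycleMinima) ≡ sum< n (λ j → ∣ fun v j - j ∣))
  shallow⇔ = mk⇔
    (λ t → subst₂ (λ i c → i + (n ∸ c) ≡ sum< n (λ j → ∣ fun v j - j ∣)) Inv≡ cyc≡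
                  (trans (≡ᵇ⇒≡ _ _ t) Dis≡))
    (λ eq → ≡⇒≡ᵇ _ _ (trans (cong₂ (λ i c → i + (n ∸ c)) Inv≡ cyc≡) (trans eq (sym Dis≡))))

good⇔IsGood : ∀ {n} (v : Vec (Fin n) n) → T (good v) ⇔ IsGood n (fun v)
good⇔IsGood {n} v = mk⇔ ⇒ ⇐
  where
  open Equivalence
  ⇒ : T (good v) → IsGood n (fun v)
  ⇒ t with T-∧⁴⁻ (isPerm v) (shallow v) (avoids321 v) (persymmetric v) t
  ... | tperm , tshallow , tavoids , tpersym = record
    { bounded     = fun-bounded v
    ; injective   = injective
    ; avoiding    = avoiding
    ; persym      = to (persymmetric⇔Persymmetric v) tpersym
    ; oneCrossing = to (Permutation.shallow⇔oneCrossing (fun-bounded v) injective avoiding)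
                       (to (shallow⇔ v) tshallow)
    }
    where
    injective : InjectiveBelow n (fun v)
    injective = to (isPerm⇔injective v) tperm
    avoiding : Avoids321 n (fun v)
    avoiding = to (avoids321⇔Avoids321 v) tavoids
  ⇐ : IsGood n (fun v) → T (good v)
  ⇐ isGood = T-∧⁴⁺ (isPerm v) (shallow v) (avoids321 v) (persymmetric v)
    (from (isPerm⇔injective v) injective)
    (from (shallow⇔ v) (from (Permutation.shallow⇔oneCrossing bounded injective avoiding) oneCrossing))
    (from (avoids321⇔Avoids321 v) avoiding)
    (from (persymmetric⇔Persymmetric v) persym)
    where open IsGood isGood

-- Adjacent transpositions

swapAt : ℕ → ℕ → ℕ
swapAt zero    zero          = 1
swapAt zero    (suc zero)    = 0
swapAt zero    (suc (suc x)) = suc (suc x)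
swapAt (suc k) zero          = zero
swapAt (suc k) (suc x)       = suc (swapAt k x)

swapAt-involutive : ∀ k x → swapAt k (swapAt k x) ≡ x
swapAt-involutive zero    zero          = refl
swapAt-involutive zero    (suc zero)    = refl
swapAt-involutive zero    (suc (suc x)) = refl
swapAt-involutive (suc k) zero          = refl
swapAt-involutive (suc k) (suc x)       = cong suc (swapAt-involutive k x)

swapAt-injective : ∀ k {x y} → swapAt k x ≡ swapAt k y → x ≡ y
swapAt-injective k {x} {y} eq =
  trans (sym (swapAt-involutive k x)) (trans (cong (swapAt k) eq) (swapAt-involutive k y))

swapAt-at : ∀ k → swapAt k k ≡ suc k
swapAt-at zero    = refl
swapAt-at (suc k) = cong suc (swapAt-at k)

swapAt-next : ∀ k → swapAt k (suc k) ≡ k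
swapAt-next zero    = refl
swapAt-next (suc k) = cong suc (swapAt-next k)

swapAt-below : ∀ k x → x < k → swapAt k x ≡ x
swapAt-below (suc k) zero    _         = refl
swapAt-below (suc k) (suc x) (s≤s x<k) = cong suc (swapAt-below k x x<k)

swapAt-above : ∀ k x → suc k < x → swapAt k x ≡ x
swapAt-above zero    (suc zero)    (s≤s ())
swapAt-above zero    (suc (suc x)) _            = refl
swapAt-above (suc k) (suc x)       (s≤s 1+k<x) = cong suc (swapAt-above k x 1+k<x)

swapAt-preserves-cut : ∀ k {a x} → a ≢ suc k → x < a → swapAt k x < a
swapAt-preserves-cut zero    {suc zero}    a≢1 _ = contradiction refl a≢1
swapAt-preserves-cut zero    {suc (suc a)} {zero}        _ _  = s≤s (s≤s z≤n)
swapAt-preserves-cut zero    {suc (suc a)} {suc zero}    _ _  = s≤s z≤n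
swapAt-preserves-cut zero    {suc (suc a)} {suc (suc x)} _ x<a = x<a
swapAt-preserves-cut (suc k) {suc a}       {zero}        _ _  = s≤s z≤n
swapAt-preserves-cut (suc k) {suc a}       {suc x}       a≢ (s≤s x<a) =
  s≤s (swapAt-preserves-cut k (a≢ ∘ cong suc) x<a)

swapAt-reflects-cut : ∀ k {a y} → a ≢ suc k → a ≤ swapAt k y → a ≤ y
swapAt-reflects-cut k a≢ a≤τy = ≮⇒≥ (λ y<a → <⇒≱ (swapAt-preserves-cut k a≢ y<a) a≤τy)

swapAt-bounded : ∀ k {n x} → suc k < n → x < n → swapAt k x < n
swapAt-bounded k 1+k<n = swapAt-preserves-cut k (>⇒≢ 1+k<n)

swapAt-mono : ∀ k {x y} → x < y → ¬ (x ≡ k × y ≡ suc k) → swapAt k x < swapAt k y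
swapAt-mono zero    {zero}        {suc zero}    _ not01 = contradiction (refl , refl) not01
swapAt-mono zero    {zero}        {suc (suc y)} _ _     = s≤s (s≤s z≤n)
swapAt-mono zero    {suc zero}    {suc zero}    (s≤s ()) _
swapAt-mono zero    {suc zero}    {suc (suc y)} _ _     = s≤s z≤n
swapAt-mono zero    {suc (suc x)} {suc zero}    (s≤s ()) _
swapAt-mono zero    {suc (suc x)} {suc (suc y)} x<y _   = x<y
swapAt-mono (suc k) {zero}        {suc y}       _ _     = s≤s z≤n
swapAt-mono (suc k) {suc x}       {suc y}       (s≤s x<y) not-k =
  s≤s (swapAt-mono k x<y (λ (x≡k , y≡1+k) → not-k (cong suc x≡k , cong suc y≡1+k)))

swapAt-reflects-order : ∀ k {x y} → swapAt k y < swapAt k x → y < x ⊎ (y ≡ suc k × x ≡ k)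
swapAt-reflects-order k {x} {y} τy<τx with swapAt k y ≟ k | swapAt k x ≟ suc k
... | yes τy≡k | yes τx≡1+k =
  inj₂ (trans (sym (swapAt-involutive k y)) (trans (cong (swapAt k) τy≡k) (swapAt-at k)) ,
        trans (sym (swapAt-involutive k x)) (trans (cong (swapAt k) τx≡1+k) (swapAt-next k)))
... | no τy≢k | _ = inj₁ (subst₂ _<_ (swapAt-involutive k y) (swapAt-involutive k x)
                           (swapAt-mono k τy<τx (τy≢k ∘ proj₁)))
... | yes _ | no τx≢1+k = inj₁ (subst₂ _<_ (swapAt-involutive k y) (swapAt-involutive k x)
                                (swapAt-mono k τy<τx (τx≢1+k ∘ proj₂)))

swapAt-complement : ∀ m k x → k ≤ m → x ≤ suc m → suc m ∸ swapAt k x ≡ swapAt (m ∸ k) (suc m ∸ x)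
swapAt-complement m       zero    zero          _ _ = sym (swapAt-next m)
swapAt-complement m       zero    (suc zero)    _ _ = sym (swapAt-at m)
swapAt-complement m       zero    (suc (suc x)) _ (s≤s 2+x≤1+m) =
  sym (swapAt-below m (m ∸ suc x) (∸-monoʳ-< z<s 2+x≤1+m))
swapAt-complement (suc m) (suc k) zero          _ _ =
  sym (swapAt-above (m ∸ k) (suc (suc m)) (s≤s (s≤s (m∸n≤m m k))))
swapAt-complement (suc m) (suc k) (suc x)       (s≤s k≤m) (s≤s x≤1+m) =
  swapAt-complement m k x k≤m x≤1+m

swapAt-keeps-≥2 : ∀ {m x} → 2 ≤ m → 2 ≤ x → 2 ≤ swapAt m x
swapAt-keeps-≥2 {m} {x} 2≤m 2≤x =
  swapAt-reflects-cut m (λ 2≡1+m → <⇒≢ 2≤m (suc-injective 2≡1+m))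
                        (subst (2 ≤_) (sym (swapAt-involutive m x)) 2≤x)

-- Exchanging two adjacent entries can only create a 321 that uses both of them.
avoids-∘swapAt : ∀ {n g} k → suc k < n → Avoids321 n g →
                 (∀ i → i < k → g k < g (suc k) → g (suc k) < g i → ⊥) →
                 (∀ l → suc k < l → l < n → g l < g k → g k < g (suc k) → ⊥) →
                 Avoids321 n (g ∘ swapAt k)
avoids-∘swapAt {n} {g} k 1+k<n avoids before after i j l i<j j<l l<n gj<gi gl<gj
  with (i ≟ k) ×-dec (j ≟ suc k) | (j ≟ k) ×-dec (l ≟ suc k)
... | yes (refl , refl) | _ =
  after l j<l l<n (subst₂ _<_ (cong g (swapAt-above k l j<l)) (cong g (swapAt-next k)) gl<gj)
                  (subst₂ _<_ (cong g (swapAt-next k)) (cong g (swapAt-at k)) gj<gi)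
... | no _ | yes (refl , refl) =
  before i i<j (subst₂ _<_ (cong g (swapAt-next k)) (cong g (swapAt-at k)) gl<gj)
               (subst₂ _<_ (cong g (swapAt-at k)) (cong g (swapAt-below k i i<j)) gj<gi)
... | no not-ij | no not-jl =
  avoids (swapAt k i) (swapAt k j) (swapAt k l) (swapAt-mono k i<j not-ij) (swapAt-mono k j<l not-jl)
         (swapAt-bounded k 1+k<n l<n) gj<gi gl<gj

-- Exchanging two adjacent values can only create a 321 that uses both of them.
avoids-swapAt∘ : ∀ {n g} k → InjectiveBelow n g → Avoids321 n g →
                 (∀ i j l → i < j → j < l → l < n → g i ≡ k → g j ≡ suc k → g l < k → ⊥) →
                 (∀ i j l → i < j → j < l → l < n → suc k < g i → g j ≡ k → g l ≡ suc k → ⊥) →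
                 Avoids321 n (swapAt k ∘ g)
avoids-swapAt∘ {n} {g} k injective avoids lowTail highHead i j l i<j j<l l<n τgj<τgi τgl<τgj
  with swapAt-reflects-order k τgj<τgi | swapAt-reflects-order k τgl<τgj
... | inj₁ gj<gi | inj₁ gl<gj = avoids i j l i<j j<l l<n gj<gi gl<gj
... | inj₂ (gj≡1+k , gi≡k) | inj₁ gl<gj =
  lowTail i j l i<j j<l l<n gi≡k gj≡1+k
    (≤∧≢⇒< (≤-pred (subst (g l <_) gj≡1+k gl<gj))
           (λ gl≡k → <-irrefl (injective i l (<-trans i<j (<-trans j<l l<n)) l<n (trans gi≡k (sym gl≡k)))
                              (<-trans i<j j<l)))
... | inj₂ (gj≡1+k , _) | inj₂ (_ , gj≡k) = <-irrefl (trans (sym gj≡k) gj≡1+k) (n<1+n k)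
... | inj₁ gj<gi | inj₂ (gl≡1+k , gj≡k) =
  highHead i j l i<j j<l l<n
    (≤∧≢⇒< (subst (_< g i) gj≡k gj<gi)
           (λ 1+k≡gi → <-irrefl (injective i l (<-trans i<j (<-trans j<l l<n)) l<n
                                          (trans (sym 1+k≡gi) (sym gl≡1+k)))
                                (<-trans i<j j<l)))
    gj≡k gl≡1+k

sandwich : ℕ → ℕ → (ℕ → ℕ) → ℕ → ℕ
sandwich k l g = swapAt k ∘ g ∘ swapAt l

sandwich-involutive : ∀ k l g i → sandwich k l (sandwich k l g) i ≡ g i
sandwich-involutive k l g i = trans (swapAt-involutive k _) (cong g (swapAt-involutive l i))

sandwich-bounded : ∀ {n g} k l → suc k < n → suc l < n → Bounded n g → Bounded n (sandwich k l g)
sandwich-bounded k l 1+k<n 1+l<n bounded i i<n =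
  swapAt-bounded k 1+k<n (bounded _ (swapAt-bounded l 1+l<n i<n))

injective-∘swapAt : ∀ {n g} l → suc l < n → InjectiveBelow n g → InjectiveBelow n (g ∘ swapAt l)
injective-∘swapAt l 1+l<n injective i j i<n j<n eq =
  swapAt-injective l (injective _ _ (swapAt-bounded l 1+l<n i<n) (swapAt-bounded l 1+l<n j<n) eq)

sandwich-injective : ∀ {n g} k l → suc l < n → InjectiveBelow n g → InjectiveBelow n (sandwich k l g)
sandwich-injective k l 1+l<n injective i j i<n j<n eq =
  injective-∘swapAt l 1+l<n injective i j i<n j<n (swapAt-injective k eq)

sandwich-cancel : ∀ {n g g'} k l → suc l < n → (∀ i → i < n → sandwich k l g i ≡ sandwich k l g' i) →
                  ∀ i → i < n → g i ≡ g' i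
sandwich-cancel {g = g} {g'} k l 1+l<n same i i<n =
  swapAt-injective k (subst (λ j → swapAt k (g j) ≡ swapAt k (g' j)) (swapAt-involutive l i)
                            (same (swapAt l i) (swapAt-bounded l 1+l<n i<n)))

sandwich-persym : ∀ {N g} k l → suc l < suc N → Bounded (suc N) g →
                  (∀ y → y < suc N → N ∸ swapAt k y ≡ swapAt l (N ∸ y)) →
                  Persymmetric (suc N) g → Persymmetric (suc N) (sandwich k l g)
sandwich-persym {N} {g} k l 1+l<n bounded reflect persym i i<n = begin
  N ∸ swapAt k (g (swapAt l (N ∸ swapAt k y)))      ≡⟨ cong (λ z → N ∸ swapAt k (g (swapAt l z))) (reflect y y<n) ⟩
  N ∸ swapAt k (g (swapAt l (swapAt l (N ∸ y))))    ≡⟨ cong (λ z → N ∸ swapAt k (g z)) (swapAt-involutive l _) ⟩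
  N ∸ swapAt k (g (N ∸ y))                          ≡⟨ reflect (g (N ∸ y)) (bounded _ (s≤s (m∸n≤m N y))) ⟩
  swapAt l (N ∸ g (N ∸ y))                          ≡⟨ cong (swapAt l) (persym _ (swapAt-bounded l 1+l<n i<n)) ⟩
  swapAt l (swapAt l i)                             ≡⟨ swapAt-involutive l i ⟩
  i                                                 ∎
  where
  open ≡-Reasoning
  y : ℕ
  y = g (swapAt l i)
  y<n : y < suc N
  y<n = bounded _ (swapAt-bounded l 1+l<n i<n)

-- The cuts 1 and N are crossed at most once by any permutation of {0, …, N}; the other cuts
-- are respected by both transpositions.
sandwich-oneCrossing : ∀ {N g} k l → suc k < suc N → suc l < suc N →
                       (suc k ≡ 1 ⊎ suc k ≡ N) → (suc l ≡ 1 ⊎ suc l ≡ N) →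
                       Bounded (suc N) g → InjectiveBelow (suc N) g →
                       AtMostOneCrossing (suc N) g → AtMostOneCrossing (suc N) (sandwich k l g)
sandwich-oneCrossing {N} {g} k l 1+k<n 1+l<n k-edge l-edge bounded injective oneCrossing
                     a p p' a≤n p<a p'<a a≤hp a≤hp' with a ≟ 1 | a ≟ N
... | yes refl | _ = trans (n<1⇒n≡0 p<a) (sym (n<1⇒n≡0 p'<a))
... | no _ | yes refl =
  sandwich-injective k l 1+l<n injective p p' (<-≤-trans p<a a≤n) (<-≤-trans p'<a a≤n)
                     (trans (top (<-≤-trans p<a a≤n) a≤hp) (sym (top (<-≤-trans p'<a a≤n) a≤hp')))
  where
  top : ∀ {q} → q < suc N → N ≤ sandwich k l g q → sandwich k l g q ≡ N
  top q<n N≤hq = ≤-antisym (≤-pred (sandwich-bounded k l 1+k<n 1+l<n bounded _ q<n)) N≤hq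
... | no a≢1 | no a≢N =
  swapAt-injective l (oneCrossing a (swapAt l p) (swapAt l p') a≤n
    (swapAt-preserves-cut l (off l-edge) p<a) (swapAt-preserves-cut l (off l-edge) p'<a)
    (swapAt-reflects-cut k (off k-edge) a≤hp) (swapAt-reflects-cut k (off k-edge) a≤hp'))
  where
  off : ∀ {j} → suc j ≡ 1 ⊎ suc j ≡ N → a ≢ suc j
  off (inj₁ 1+j≡1) a≡1+j = a≢1 (trans a≡1+j 1+j≡1)
  off (inj₂ 1+j≡N) a≡1+j = a≢N (trans a≡1+j 1+j≡N)

sandwich-IsGood : ∀ {N g} k l → suc k < suc N → suc l < suc N →
                  (suc k ≡ 1 ⊎ suc k ≡ N) → (suc l ≡ 1 ⊎ suc l ≡ N) →
                  (∀ y → y < suc N → N ∸ swapAt k y ≡ swapAt l (N ∸ y)) →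
                  Avoids321 (suc N) (sandwich k l g) → IsGood (suc N) g → IsGood (suc N) (sandwich k l g)
sandwich-IsGood k l 1+k<n 1+l<n k-edge l-edge reflect avoids g-good = record
  { bounded     = sandwich-bounded k l 1+k<n 1+l<n bounded
  ; injective   = sandwich-injective k l 1+l<n injective
  ; avoiding    = avoids
  ; persym      = sandwich-persym k l 1+l<n bounded reflect persym
  ; oneCrossing = sandwich-oneCrossing k l 1+k<n 1+l<n k-edge l-edge bounded injective oneCrossing
  }
  where open IsGood g-good

-- The inflation 1 ⊕ σ ⊕ 1

wrap : ℕ → (ℕ → ℕ) → ℕ → ℕ
wrap m σ zero    = zero
wrap m σ (suc i) = if i <ᵇ m then suc (σ i) else suc m

unwrap : (ℕ → ℕ) → ℕ → ℕ
unwrap g i = pred (g (suc i))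

record Wraps (m : ℕ) (σ g : ℕ → ℕ) : Set where
  field
    first  : g 0 ≡ 0
    middle : ∀ i → i < m → g (suc i) ≡ suc (σ i)
    last   : g (suc m) ≡ suc m

wrap-Wraps : ∀ m σ → Wraps m σ (wrap m σ)
wrap-Wraps m σ = record { first = refl ; middle = middle ; last = last }
  where
  middle : ∀ i → i < m → wrap m σ (suc i) ≡ suc (σ i)
  middle i i<m with i <ᵇ m | <⇒<ᵇ i<m
  ... | true | _ = refl
  last : wrap m σ (suc m) ≡ suc m
  last with m <ᵇ m | <ᵇ⇒< m m
  ... | false | _   = refl
  ... | true  | m<m = contradiction (m<m _) (<-irrefl refl)

data Position (m : ℕ) : ℕ → Set where
  atFirst  : Position m 0
  inMiddle : ∀ i → i < m → Position m (suc i)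
  atLast   : Position m (suc m)

position : ∀ m i → i < suc (suc m) → Position m i
position m zero    _           = atFirst
position m (suc i) (s≤s i≤1+m) with i <? m
... | yes i<m = inMiddle i i<m
... | no  i≮m rewrite ≤-antisym (≤-pred i≤1+m) (≮⇒≥ i≮m) = atLast

module _ {m : ℕ} {σ g : ℕ → ℕ} (wraps : Wraps m σ g) where

  open Wraps wraps

  private
    N n : ℕ
    N = suc m
    n = suc N

  Wraps-persym-middle : Bounded m σ → ∀ i → i < m →
                        N ∸ g (N ∸ g (suc i)) ≡ suc ((m ∸ 1) ∸ σ ((m ∸ 1) ∸ σ i))
  Wraps-persym-middle σ-bounded i i<m = begin
    N ∸ g (N ∸ g (suc i))        ≡⟨ cong (λ y → N ∸ g (N ∸ y)) (middle i i<m) ⟩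
    N ∸ g (m ∸ σ i)              ≡⟨ cong (λ y → N ∸ g y) (m∸x≡suc[m∸1∸x] (σ-bounded i i<m)) ⟩
    N ∸ g (suc t)                ≡⟨ cong (N ∸_) (middle t t<m) ⟩
    m ∸ σ t                      ≡⟨ m∸x≡suc[m∸1∸x] (σ-bounded t t<m) ⟩
    suc ((m ∸ 1) ∸ σ t)          ∎
    where
    open ≡-Reasoning
    t : ℕ
    t = (m ∸ 1) ∸ σ i
    t<m : t < m
    t<m = m∸1∸x<m m (σ i) (≤-<-trans z≤n i<m)

  Wraps-bounded : Bounded m σ → Bounded n g
  Wraps-bounded σ-bounded i i<n with position m i i<n
  ... | atFirst        = subst (_< n) (sym first) z<s
  ... | inMiddle j j<m = subst (_< n) (sym (middle j j<m)) (s≤s (s≤s (<⇒≤ (σ-bounded j j<m))))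
  ... | atLast         = subst (_< n) (sym last) (n<1+n N)

  middle<1+m : Bounded m σ → ∀ i → i < m → g (suc i) < N
  middle<1+m σ-bounded i i<m = subst (_< N) (sym (middle i i<m)) (s≤s (σ-bounded i i<m))

  Wraps-injective⁺ : Bounded m σ → InjectiveBelow m σ → InjectiveBelow n g
  Wraps-injective⁺ σ-bounded σ-injective i j i<n j<n gi≡gj with position m i i<n | position m j j<n
  ... | atFirst          | atFirst          = refl
  ... | atFirst          | inMiddle j' j'<m =
    contradiction (trans (sym first) (trans gi≡gj (middle j' j'<m))) 0≢1+n
  ... | atFirst          | atLast           = contradiction (trans (sym first) (trans gi≡gj last)) 0≢1+n
  ... | inMiddle i' i'<m | atFirst          =
    contradiction (trans (sym first) (trans (sym gi≡gj) (middle i' i'<m))) 0≢1+n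
  ... | inMiddle i' i'<m | inMiddle j' j'<m =
    cong suc (σ-injective i' j' i'<m j'<m
               (suc-injective (trans (sym (middle i' i'<m)) (trans gi≡gj (middle j' j'<m)))))
  ... | inMiddle i' i'<m | atLast           = contradiction (trans gi≡gj last) (<⇒≢ (middle<1+m σ-bounded i' i'<m))
  ... | atLast           | atFirst          = contradiction (trans (sym first) (trans (sym gi≡gj) last)) 0≢1+n
  ... | atLast           | inMiddle j' j'<m = contradiction (trans (sym gi≡gj) last) (<⇒≢ (middle<1+m σ-bounded j' j'<m))
  ... | atLast           | atLast           = refl

  Wraps-avoids⁺ : Bounded m σ → Avoids321 m σ → Avoids321 n g
  Wraps-avoids⁺ σ-bounded σ-avoids i j l i<j j<l l<n gj<gi gl<gj
    with position m i (<-trans i<j (<-trans j<l l<n)) | position m j (<-trans j<l l<n) | position m l l<n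
  ... | atFirst | _ | _ = n≮0 (subst (g j <_) first gj<gi)
  ... | atLast  | _ | _ = <⇒≱ (<-trans i<j j<l) (≤-pred l<n)
  ... | _ | atLast  | _ = <⇒≱ j<l (≤-pred l<n)
  ... | inMiddle _ _ | atFirst | _ = n≮0 i<j
  ... | inMiddle _ _ | inMiddle _ _ | atFirst = n≮0 j<l
  ... | inMiddle _ _ | inMiddle j' j'<m | atLast =
    <-asym gl<gj (subst (g (suc j') <_) (sym last) (middle<1+m σ-bounded j' j'<m))
  ... | inMiddle i' i'<m | inMiddle j' j'<m | inMiddle l' l'<m =
    σ-avoids i' j' l' (≤-pred i<j) (≤-pred j<l) l'<m
      (≤-pred (subst₂ _<_ (middle j' j'<m) (middle i' i'<m) gj<gi))
      (≤-pred (subst₂ _<_ (middle l' l'<m) (middle j' j'<m) gl<gj))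

  Wraps-persym⁺ : Bounded m σ → Persymmetric m σ → Persymmetric n g
  Wraps-persym⁺ σ-bounded σ-persym i i<n with position m i i<n
  ... | atFirst = trans (cong (λ y → N ∸ g (N ∸ y)) first) (trans (cong (N ∸_) last) (n∸n≡0 N))
  ... | atLast  = trans (cong (λ y → N ∸ g y) (trans (cong (N ∸_) last) (n∸n≡0 N))) (cong (N ∸_) first)
  ... | inMiddle i' i'<m = trans (Wraps-persym-middle σ-bounded i' i'<m) (cong suc (σ-persym i' i'<m))

  Wraps-crossing : Bounded m σ → ∀ {a p} → a ≤ n → p < a → a ≤ g p →
                   ∃[ a' ] ∃[ q ] (a ≡ suc a' × p ≡ suc q × q < m × a' ≤ m × q < a' × a' ≤ σ q)
  Wraps-crossing σ-bounded {a} {p} a≤n p<a a≤gp with position m p (<-≤-trans p<a a≤n)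
  ... | atFirst = contradiction (subst (a ≤_) first a≤gp) (<⇒≱ p<a)
  ... | atLast  = contradiction (subst (a ≤_) last a≤gp) (<⇒≱ p<a)
  Wraps-crossing σ-bounded {suc a'} a≤n (s≤s q<a') a≤gp | inMiddle q q<m =
    a' , q , refl , refl , q<m , <⇒≤ (≤-<-trans a'≤σq (σ-bounded q q<m)) , q<a' , a'≤σq
    where
    a'≤σq : a' ≤ σ q
    a'≤σq = ≤-pred (subst (suc a' ≤_) (middle q q<m) a≤gp)

  Wraps-oneCrossing⁺ : Bounded m σ → AtMostOneCrossing m σ → AtMostOneCrossing n g
  Wraps-oneCrossing⁺ σ-bounded σ-oneCrossing a p p' a≤n p<a p'<a a≤gp a≤gp'
    with Wraps-crossing σ-bounded a≤n p<a a≤gp | Wraps-crossing σ-bounded a≤n p'<a a≤gp'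
  ... | a' , q , refl , refl , q<m , a'≤m , q<a' , a'≤σq | _ , q' , refl , refl , q'<m , _ , q'<a' , a'≤σq' =
    cong suc (σ-oneCrossing a' q q' a'≤m q<a' q'<a' a'≤σq a'≤σq')

  Wraps-IsGood⁺ : IsGood m σ → IsGood n g
  Wraps-IsGood⁺ σ-good = record
    { bounded     = Wraps-bounded bounded
    ; injective   = Wraps-injective⁺ bounded injective
    ; avoiding    = Wraps-avoids⁺ bounded avoiding
    ; persym      = Wraps-persym⁺ bounded persym
    ; oneCrossing = Wraps-oneCrossing⁺ bounded oneCrossing
    }
    where open IsGood σ-good

  Wraps-IsGood⁻ : IsGood n g → IsGood m σ
  Wraps-IsGood⁻ g-good = record
    { bounded = bounded ; injective = injective ; avoiding = avoiding
    ; persym = persym ; oneCrossing = oneCrossing }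
    where
    module G = IsGood g-good
    inner : ∀ {i} → i < m → suc i < n
    inner i<m = s≤s (<-trans i<m (n<1+n m))
    bounded : Bounded m σ
    bounded i i<m = ≤∧≢⇒< (≤-pred (≤-pred (subst (_< n) (middle i i<m) (G.bounded _ (inner i<m)))))
      (λ σi≡m → <-irrefl (suc-injective (G.injective _ _ (inner i<m) (n<1+n N)
                            (trans (middle i i<m) (trans (cong suc σi≡m) (sym last))))) i<m)
    injective : InjectiveBelow m σ
    injective i j i<m j<m σi≡σj = suc-injective (G.injective _ _ (inner i<m) (inner j<m)
      (trans (middle i i<m) (trans (cong suc σi≡σj) (sym (middle j j<m)))))
    avoiding : Avoids321 m σ
    avoiding i j l i<j j<l l<m σj<σi σl<σj = G.avoiding (suc i) (suc j) (suc l) (s≤s i<j) (s≤s j<l) (inner l<m)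
      (subst₂ _<_ (sym (middle j j<m)) (sym (middle i i<m)) (s≤s σj<σi))
      (subst₂ _<_ (sym (middle l l<m)) (sym (middle j j<m)) (s≤s σl<σj))
      where
      j<m : j < m
      j<m = <-trans j<l l<m
      i<m : i < m
      i<m = <-trans i<j j<m
    persym : Persymmetric m σ
    persym i i<m = suc-injective (trans (sym (Wraps-persym-middle bounded i i<m)) (G.persym (suc i) (inner i<m)))
    oneCrossing : AtMostOneCrossing m σ
    oneCrossing a i j a≤m i<a j<a a≤σi a≤σj = suc-injective
      (G.oneCrossing (suc a) (suc i) (suc j) (s≤s (≤-trans a≤m (n≤1+n m))) (s≤s i<a) (s≤s j<a)
        (subst (suc a ≤_) (sym (middle i (<-≤-trans i<a a≤m))) (s≤s a≤σi))
        (subst (suc a ≤_) (sym (middle j (<-≤-trans j<a a≤m))) (s≤s a≤σj)))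

unwrap-Wraps : ∀ {m g} → IsGood (suc (suc m)) g → g 0 ≡ 0 → Wraps m (unwrap g) g
unwrap-Wraps {m} {g} g-good g0≡0 = record { first = g0≡0 ; middle = middle ; last = last }
  where
  open IsGood g-good
  last : g (suc m) ≡ suc m
  last = ≤-antisym (≤-pred (bounded (suc m) ≤-refl))
                   (m∸n≡0⇒m≤n (subst (λ y → suc m ∸ g (suc m ∸ y) ≡ 0) g0≡0 (persym 0 z<s)))
  middle : ∀ i → i < m → g (suc i) ≡ suc (unwrap g i)
  middle i i<m with g (suc i) in gi
  ... | suc _ = refl
  ... | zero  = contradiction (injective (suc i) 0 (s≤s (<-trans i<m (n<1+n m))) z<s (trans gi (sym g0≡0))) 1+n≢0

Wraps-cong : ∀ {m σ g g'} → Wraps m σ g → (∀ i → i < suc (suc m) → g i ≡ g' i) → Wraps m σ g'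
Wraps-cong {m} wraps g≡g' = record
  { first  = trans (sym (g≡g' 0 z<s)) (Wraps.first wraps)
  ; middle = λ i i<m → trans (sym (g≡g' (suc i) (s≤s (<-trans i<m (n<1+n m))))) (Wraps.middle wraps i i<m)
  ; last   = trans (sym (g≡g' (suc m) ≤-refl)) (Wraps.last wraps)
  }

Wraps-unique : ∀ {m σ σ' g} → Wraps m σ g → Wraps m σ' g → ∀ i → i < m → σ i ≡ σ' i
Wraps-unique w w' i i<m = suc-injective (trans (sym (Wraps.middle w i i<m)) (Wraps.middle w' i i<m))

Wraps-agree : ∀ {m σ σ' g g'} → Wraps m σ g → Wraps m σ' g' → (∀ i → i < m → σ i ≡ σ' i) →
              ∀ i → i < suc (suc m) → g i ≡ g' i
Wraps-agree {m} w w' σ≡σ' i i<n with position m i i<n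
... | atFirst        = trans (Wraps.first w) (sym (Wraps.first w'))
... | inMiddle j j<m = trans (Wraps.middle w j j<m) (trans (cong suc (σ≡σ' j j<m)) (sym (Wraps.middle w' j j<m)))
... | atLast         = trans (Wraps.last w) (sym (Wraps.last w'))

module _ {m : ℕ} (1≤m : 1 ≤ m) where

  private
    N n : ℕ
    N = suc m
    n = suc N

  reflect-swapAt-0 : ∀ y → y < n → N ∸ swapAt 0 y ≡ swapAt m (N ∸ y)
  reflect-swapAt-0 y y<n = swapAt-complement m 0 y z≤n (≤-pred y<n)

  reflect-swapAt-m : ∀ y → y < n → N ∸ swapAt m y ≡ swapAt 0 (N ∸ y)
  reflect-swapAt-m y y<n = trans (swapAt-complement m m y ≤-refl (≤-pred y<n))
                                 (cong (λ k → swapAt k (N ∸ y)) (n∸n≡0 m))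

  sandwich-0m-IsGood : ∀ {g} → IsGood n g → g m ≡ N ⊎ g N ≡ N → g 0 ≡ 0 ⊎ g 0 ≡ 1 →
                       IsGood n (sandwich 0 m g)
  sandwich-0m-IsGood {g} g-good top start =
    sandwich-IsGood 0 m (s≤s (s≤s z≤n)) ≤-refl (inj₁ refl) (inj₂ refl) reflect-swapAt-0
      (avoids-swapAt∘ 0 g'-injective g'-avoiding (λ _ _ _ _ _ _ _ _ g'l<0 → n≮0 g'l<0) (highHead start))
      g-good
    where
    module G = IsGood g-good
    g' : ℕ → ℕ
    g' = g ∘ swapAt m
    g'-injective : InjectiveBelow n g'
    g'-injective = injective-∘swapAt m ≤-refl G.injective
    g'-avoiding : Avoids321 n g'
    g'-avoiding = avoids-∘swapAt m ≤-refl G.avoiding (before top) after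
      where
      before : g m ≡ N ⊎ g N ≡ N → ∀ i → i < m → g m < g N → g N < g i → ⊥
      before (inj₁ gm≡N) i i<m gm<gN gN<gi = <⇒≱ (subst (_< g N) gm≡N gm<gN) (≤-pred (G.bounded N ≤-refl))
      before (inj₂ gN≡N) i i<m gm<gN gN<gi =
        <⇒≱ (subst (_< g i) gN≡N gN<gi) (≤-pred (G.bounded i (<-trans i<m (<-trans (n<1+n m) ≤-refl))))
      after : ∀ l → N < l → l < n → g l < g m → g m < g N → ⊥
      after l N<l l<n _ _ = <⇒≱ N<l (≤-pred l<n)
    g'0≡g0 : g' 0 ≡ g 0
    g'0≡g0 = cong g (swapAt-below m 0 1≤m)
    highHead : g 0 ≡ 0 ⊎ g 0 ≡ 1 →
               ∀ i j l → i < j → j < l → l < n → 1 < g' i → g' j ≡ 0 → g' l ≡ 1 → ⊥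
    highHead (inj₁ g0≡0) i j l i<j j<l l<n _ g'j≡0 _ =
      n≮0 (subst (i <_) (g'-injective j 0 (<-trans j<l l<n) z<s (trans g'j≡0 (sym (trans g'0≡g0 g0≡0)))) i<j)
    highHead (inj₂ g0≡1) i j l i<j j<l l<n _ _ g'l≡1 =
      n≮0 (subst (j <_) (g'-injective l 0 l<n z<s (trans g'l≡1 (sym (trans g'0≡g0 g0≡1)))) j<l)

  sandwich-m0-IsGood : ∀ {g} → IsGood n g → g 0 ≡ 0 ⊎ g 1 ≡ 0 → g N ≡ N ⊎ g N ≡ m →
                       IsGood n (sandwich m 0 g)
  sandwich-m0-IsGood {g} g-good start top =
    sandwich-IsGood m 0 ≤-refl (s≤s (s≤s z≤n)) (inj₂ refl) (inj₁ refl) reflect-swapAt-m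
      (avoids-swapAt∘ m g'-injective g'-avoiding (lowTail top) highHead)
      g-good
    where
    module G = IsGood g-good
    g' : ℕ → ℕ
    g' = g ∘ swapAt 0
    g'-injective : InjectiveBelow n g'
    g'-injective = injective-∘swapAt 0 (s≤s (s≤s z≤n)) G.injective
    g'-avoiding : Avoids321 n g'
    g'-avoiding = avoids-∘swapAt 0 (s≤s (s≤s z≤n)) G.avoiding (λ _ i<0 → contradiction i<0 n≮0) (after start)
      where
      after : g 0 ≡ 0 ⊎ g 1 ≡ 0 → ∀ l → 1 < l → l < n → g l < g 0 → g 0 < g 1 → ⊥
      after (inj₁ g0≡0) l _ _ gl<g0 _ = n≮0 (subst (g l <_) g0≡0 gl<g0)
      after (inj₂ g1≡0) l _ _ _ g0<g1 = n≮0 (subst (g 0 <_) g1≡0 g0<g1)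
    g'N≡gN : g' N ≡ g N
    g'N≡gN = cong g (swapAt-above 0 N (s≤s 1≤m))
    lowTail : g N ≡ N ⊎ g N ≡ m →
              ∀ i j l → i < j → j < l → l < n → g' i ≡ m → g' j ≡ suc m → g' l < m → ⊥
    lowTail (inj₁ gN≡N) i j l i<j j<l l<n _ g'j≡N _ =
      <⇒≱ (subst (_< l) (g'-injective j N (<-trans j<l l<n) ≤-refl (trans g'j≡N (sym (trans g'N≡gN gN≡N))))
                 j<l)
          (≤-pred l<n)
    lowTail (inj₂ gN≡m) i j l i<j j<l l<n g'i≡m _ _ =
      <⇒≱ (subst (_< j) (g'-injective i N (<-trans i<j (<-trans j<l l<n)) ≤-refl
                                       (trans g'i≡m (sym (trans g'N≡gN gN≡m))))
                 i<j)
          (≤-pred (<-trans j<l l<n))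
    highHead : ∀ i j l → i < j → j < l → l < n → suc m < g' i → g' j ≡ m → g' l ≡ suc m → ⊥
    highHead i j l i<j j<l l<n N<g'i _ _ =
      <⇒≱ N<g'i (≤-pred (G.bounded _ (swapAt-bounded 0 (s≤s (s≤s z≤n)) (<-trans i<j (<-trans j<l l<n)))))

module _ {m : ℕ} {π : ℕ → ℕ} (π-good : IsGood (suc (suc m)) π) where

  open IsGood π-good

  private
    N n : ℕ
    N = suc m
    n = suc N

  π0≡1⇒π[m]≡1+m : π 0 ≡ 1 → π m ≡ N
  π0≡1⇒π[m]≡1+m π0≡1 = ≤-antisym (≤-pred (bounded m (<-trans (n<1+n m) (n<1+n N))))
                            (m∸n≡0⇒m≤n (subst (λ y → N ∸ π (N ∸ y) ≡ 0) π0≡1 (persym 0 z<s)))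

  -- π 1 ≥ 2 would cross the cut 2 twice, and π 1 = 1 would give the 321 (0, 1, π⁻¹ 0).
  2≤π0⇒π1≡0 : 2 ≤ π 0 → π 1 ≡ 0
  2≤π0⇒π1≡0 2≤π0 with π 1 in π1
  ... | zero        = refl
  ... | suc (suc _) =
    contradiction (oneCrossing 2 0 1 (s≤s (s≤s z≤n)) z<s (s≤s z<s) 2≤π0 (subst (2 ≤_) (sym π1) (s≤s (s≤s z≤n))))
                  0≢1+n
  ... | suc zero with Permutation.surjective bounded injective 0 z<s
  ...   | zero        , _   , π0≡0 = contradiction (subst (2 ≤_) π0≡0 2≤π0) λ ()
  ...   | suc zero    , _   , π1≡0 = contradiction (trans (sym π1) π1≡0) 1+n≢0
  ...   | suc (suc z) , z<n , πz≡0 = ⊥-elim (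
    avoiding 0 1 (suc (suc z)) z<s (s≤s z<s) z<n
             (subst (_< π 0) (sym π1) 2≤π0) (subst₂ _<_ (sym πz≡0) (sym π1) z<s))

  π1≡0⇒π[1+m]≡m : π 1 ≡ 0 → π N ≡ m
  π1≡0⇒π[1+m]≡m π1≡0 = 1+m∸x≡1⇒x≡m m (π N) (≤-pred (bounded N ≤-refl))
                          (subst (λ y → N ∸ π (N ∸ y) ≡ 1) π1≡0 (persym 1 (s≤s z<s)))

data Decomposition (m : ℕ) (π : ℕ → ℕ) : Set where
  fixesFirst   : ∀ σ → IsGood m σ → Wraps m σ π → Decomposition m π
  startsAt1    : ∀ σ → IsGood m σ → Wraps m σ (sandwich 0 m π) → Decomposition m π
  startsAbove1 : ∀ σ → IsGood m σ → σ 0 ≢ 0 → Wraps m σ (sandwich m 0 π) → Decomposition m π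

decompose : ∀ {m π} → 2 ≤ m → IsGood (suc (suc m)) π → Decomposition m π
decompose {m} {π} 2≤m π-good with π 0 in π0
... | zero = fixesFirst (unwrap π) (Wraps-IsGood⁻ wraps π-good) wraps
  where
  wraps : Wraps m (unwrap π) π
  wraps = unwrap-Wraps π-good π0
... | suc zero = startsAt1 (unwrap ρ) (Wraps-IsGood⁻ wraps ρ-good) wraps
  where
  ρ : ℕ → ℕ
  ρ = sandwich 0 m π
  ρ-good : IsGood (suc (suc m)) ρ
  ρ-good = sandwich-0m-IsGood (<⇒≤ 2≤m) π-good (inj₁ (π0≡1⇒π[m]≡1+m π-good π0)) (inj₂ π0)
  wraps : Wraps m (unwrap ρ) ρ
  wraps = unwrap-Wraps ρ-good (cong (swapAt 0) (trans (cong π (swapAt-below m 0 (<⇒≤ 2≤m))) π0))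
... | suc (suc k) = startsAbove1 (unwrap ρ) (Wraps-IsGood⁻ wraps ρ-good) σ0≢0 wraps
  where
  2≤π0 : 2 ≤ π 0
  2≤π0 = subst (2 ≤_) (sym π0) (s≤s (s≤s z≤n))
  π1≡0 : π 1 ≡ 0
  π1≡0 = 2≤π0⇒π1≡0 π-good 2≤π0
  ρ : ℕ → ℕ
  ρ = sandwich m 0 π
  ρ-good : IsGood (suc (suc m)) ρ
  ρ-good = sandwich-m0-IsGood (<⇒≤ 2≤m) π-good (inj₂ π1≡0) (inj₂ (π1≡0⇒π[1+m]≡m π-good π1≡0))
  wraps : Wraps m (unwrap ρ) ρ
  wraps = unwrap-Wraps ρ-good (trans (cong (swapAt m) π1≡0) (swapAt-below m 0 (<⇒≤ 2≤m)))
  σ0≢0 : unwrap ρ 0 ≢ 0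
  σ0≢0 σ0≡0 = <⇒≢ (swapAt-keeps-≥2 2≤m 2≤π0) (sym (trans (Wraps.middle wraps 0 (<⇒≤ 2≤m)) (cong suc σ0≡0)))

module _ {m σ} (σ-good : IsGood m σ) where

  wrap-IsGood : IsGood (suc (suc m)) (wrap m σ)
  wrap-IsGood = Wraps-IsGood⁺ (wrap-Wraps m σ) σ-good

  sandwich-0m-wrap-IsGood : 1 ≤ m → IsGood (suc (suc m)) (sandwich 0 m (wrap m σ))
  sandwich-0m-wrap-IsGood 1≤m =
    sandwich-0m-IsGood 1≤m wrap-IsGood (inj₂ (Wraps.last (wrap-Wraps m σ))) (inj₁ refl)

  sandwich-m0-wrap-IsGood : 1 ≤ m → IsGood (suc (suc m)) (sandwich m 0 (wrap m σ))
  sandwich-m0-wrap-IsGood 1≤m =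
    sandwich-m0-IsGood 1≤m wrap-IsGood (inj₁ refl) (inj₁ (Wraps.last (wrap-Wraps m σ)))

sandwich-0m-wrap-start : ∀ {m} σ → 1 ≤ m → sandwich 0 m (wrap m σ) 0 ≡ 1
sandwich-0m-wrap-start {m} σ 1≤m = cong (swapAt 0 ∘ wrap m σ) (swapAt-below m 0 1≤m)

sandwich-m0-wrap-start : ∀ {m} σ → 2 ≤ m → σ 0 ≢ 0 → 2 ≤ sandwich m 0 (wrap m σ) 0
sandwich-m0-wrap-start {m} σ 2≤m σ0≢0 =
  swapAt-keeps-≥2 2≤m
    (subst (2 ≤_) (sym (Wraps.middle (wrap-Wraps m σ) 0 (<⇒≤ 2≤m))) (s≤s (n≢0⇒n>0 σ0≢0)))

-- Counting

allVecs≡cartesianProduct : ∀ n m → allVecs n (suc m) ≡ cartesianProductWith _∷_ (allFin n) (allVecs n m)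
allVecs≡cartesianProduct n m = go (allFin n)
  where
  go : ∀ xs → concatMap (λ x → map (x ∷_) (allVecs n m)) xs ≡ cartesianProductWith _∷_ xs (allVecs n m)
  go []       = refl
  go (x ∷ xs) = cong (map (x ∷_) (allVecs n m) ++_) (go xs)

allVecs-unique : ∀ n m → Unique (allVecs n m)
allVecs-unique n zero    = All.[] AllPairs.∷ AllPairs.[]
allVecs-unique n (suc m) rewrite allVecs≡cartesianProduct n m =
  Unique.cartesianProductWith⁺ _∷_ ∷-injective (Unique.allFin⁺ n) (allVecs-unique n m)

allVecs-complete : ∀ n m (v : Vec (Fin n) m) → v ∈ allVecs n m
allVecs-complete n zero    []      = here refl
allVecs-complete n (suc m) (x ∷ v) rewrite allVecs≡cartesianProduct n m =
  ∈-cartesianProductWith⁺ _∷_ (∈-allFin x) (allVecs-complete n m v)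

goodVecs : ∀ n → List (Vec (Fin n) n)
goodVecs n = filter (λ v → T? (good v)) (allVecs n n)

goodVecs-unique : ∀ n → Unique (goodVecs n)
goodVecs-unique n = Unique.filter⁺ (λ v → T? (good v)) (allVecs-unique n n)

∈goodVecs⇔IsGood : ∀ {n} (v : Vec (Fin n) n) → v ∈ goodVecs n ⇔ IsGood n (fun v)
∈goodVecs⇔IsGood {n} v = mk⇔
  (λ v∈ → Equivalence.to (good⇔IsGood v) (proj₂ (∈-filter⁻ (λ v → T? (good v)) {xs = allVecs n n} v∈)))
  (λ v-good → ∈-filter⁺ (λ v → T? (good v)) (allVecs-complete n n v)
                         (Equivalence.from (good⇔IsGood v) v-good))

startsNonzero? : ∀ {k} (σ : Vec (Fin k) k) → Dec (fun σ 0 ≢ 0)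
startsNonzero? σ = ¬? (fun σ 0 ≟ 0)

nonzeroVecs : ∀ n → List (Vec (Fin n) n)
nonzeroVecs n = filter startsNonzero? (goodVecs n)

length-by-membership : ∀ {A : Set} {xs ys : List A} → Unique xs → Unique ys →
                       (∀ {z} → z ∈ xs ⇔ z ∈ ys) → length xs ≡ length ys
length-by-membership xs! ys! same = ↭-length (∼bag⇒↭ (unique∧set⇒bag xs! ys! same))

module Recursion (m : ℕ) (2≤m : 2 ≤ m) where

  private
    N n : ℕ
    N = suc m
    n = suc N
    1≤m : 1 ≤ m
    1≤m = <⇒≤ 2≤m
    1<n : 1 < n
    1<n = s≤s (s≤s z≤n)

  wrapped : Vec (Fin m) m → ℕ → ℕ
  wrapped σ = wrap m (fun σ)

  wrapped-bounded : ∀ σ → Bounded n (wrapped σ)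
  wrapped-bounded σ = Wraps-bounded (wrap-Wraps m (fun σ)) (fun-bounded σ)

  boundedB : ∀ σ → Bounded n (sandwich 0 m (wrapped σ))
  boundedB σ = sandwich-bounded 0 m 1<n ≤-refl (wrapped-bounded σ)

  boundedC : ∀ σ → Bounded n (sandwich m 0 (wrapped σ))
  boundedC σ = sandwich-bounded m 0 ≤-refl 1<n (wrapped-bounded σ)

  embedA embedB embedC : Vec (Fin m) m → Vec (Fin n) n
  embedA σ = toVec (wrapped σ) (wrapped-bounded σ)
  embedB σ = toVec (sandwich 0 m (wrapped σ)) (boundedB σ)
  embedC σ = toVec (sandwich m 0 (wrapped σ)) (boundedC σ)

  funA : ∀ σ i → i < n → fun (embedA σ) i ≡ wrapped σ i
  funA σ = fun-toVec (wrapped σ) (wrapped-bounded σ)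

  funB : ∀ σ i → i < n → fun (embedB σ) i ≡ sandwich 0 m (wrapped σ) i
  funB σ = fun-toVec (sandwich 0 m (wrapped σ)) (boundedB σ)

  funC : ∀ σ i → i < n → fun (embedC σ) i ≡ sandwich m 0 (wrapped σ) i
  funC σ = fun-toVec (sandwich m 0 (wrapped σ)) (boundedC σ)

  wrapsA : ∀ σ → Wraps m (fun σ) (fun (embedA σ))
  wrapsA σ = Wraps-cong (wrap-Wraps m (fun σ)) (λ i i<n → sym (funA σ i i<n))

  wrapsB : ∀ σ → Wraps m (fun σ) (sandwich 0 m (fun (embedB σ)))
  wrapsB σ = Wraps-cong (wrap-Wraps m (fun σ)) (λ i i<n →
    trans (sym (sandwich-involutive 0 m (wrapped σ) i))
          (cong (swapAt 0) (sym (funB σ (swapAt m i) (swapAt-bounded m ≤-refl i<n)))))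

  wrapsC : ∀ σ → Wraps m (fun σ) (sandwich m 0 (fun (embedC σ)))
  wrapsC σ = Wraps-cong (wrap-Wraps m (fun σ)) (λ i i<n →
    trans (sym (sandwich-involutive m 0 (wrapped σ) i))
          (cong (swapAt m) (sym (funC σ (swapAt 0 i) (swapAt-bounded 0 1<n i<n)))))

  startA : ∀ σ → fun (embedA σ) 0 ≡ 0
  startA σ = funA σ 0 z<s

  startB : ∀ σ → fun (embedB σ) 0 ≡ 1
  startB σ = trans (funB σ 0 z<s) (sandwich-0m-wrap-start (fun σ) 1≤m)

  startC : ∀ σ → fun σ 0 ≢ 0 → 2 ≤ fun (embedC σ) 0
  startC σ σ0≢0 = subst (2 ≤_) (sym (funC σ 0 z<s)) (sandwich-m0-wrap-start (fun σ) 2≤m σ0≢0)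

  embed-injective : ∀ (embed : Vec (Fin m) m → Vec (Fin n) n) (Φ : (ℕ → ℕ) → ℕ → ℕ) →
                    (∀ σ → Wraps m (fun σ) (Φ (fun (embed σ)))) →
                    ∀ {σ σ'} → embed σ ≡ embed σ' → σ ≡ σ'
  embed-injective embed Φ wraps {σ} {σ'} eq = fun-injective σ σ'
    (Wraps-unique (wraps σ) (subst (λ v → Wraps m (fun σ') (Φ (fun v))) (sym eq) (wraps σ')))

  embedded-good : ∀ (embed : Vec (Fin m) m → Vec (Fin n) n) (Φ : (ℕ → ℕ) → ℕ → ℕ) →
                  (∀ σ i → i < n → fun (embed σ) i ≡ Φ (fun σ) i) →
                  (∀ {σ} → IsGood m σ → IsGood n (Φ σ)) →
                  ∀ {σ} → σ ∈ goodVecs m → embed σ ∈ goodVecs n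
  embedded-good embed Φ fun-embed Φ-good {σ} σ∈ =
    Equivalence.from (∈goodVecs⇔IsGood (embed σ))
      (IsGood-cong (Φ-good (Equivalence.to (∈goodVecs⇔IsGood σ) σ∈))
                   (λ i i<n → sym (fun-embed σ i i<n)))

  nonzeroCandidates : List (Vec (Fin n) n)
  nonzeroCandidates = map embedB (goodVecs m) ++ map embedC (nonzeroVecs m)

  candidates : List (Vec (Fin n) n)
  candidates = map embedA (goodVecs m) ++ nonzeroCandidates

  startA∈ : ∀ {v} → v ∈ map embedA (goodVecs m) → fun v 0 ≡ 0
  startA∈ v∈ with ∈-map⁻ embedA v∈
  ... | σ , _ , refl = startA σ

  startB∈ : ∀ {v} → v ∈ map embedB (goodVecs m) → fun v 0 ≡ 1
  startB∈ v∈ with ∈-map⁻ embedB v∈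
  ... | σ , _ , refl = startB σ

  startC∈ : ∀ {v} → v ∈ map embedC (nonzeroVecs m) → 2 ≤ fun v 0
  startC∈ v∈ with ∈-map⁻ embedC v∈
  ... | σ , σ∈ , refl = startC σ (proj₂ (∈-filter⁻ startsNonzero? {xs = goodVecs m} σ∈))

  nonzeroStart∈ : ∀ {v} → v ∈ nonzeroCandidates → fun v 0 ≢ 0
  nonzeroStart∈ v∈ v0≡0 with ∈-++⁻ (map embedB (goodVecs m)) v∈
  ... | inj₁ v∈B = 1+n≢0 (trans (sym (startB∈ v∈B)) v0≡0)
  ... | inj₂ v∈C = n≮0 (subst (1 <_) v0≡0 (startC∈ v∈C))

  nonzeroCandidates-sound : ∀ {v} → v ∈ nonzeroCandidates → v ∈ goodVecs n
  nonzeroCandidates-sound v∈ with ∈-++⁻ (map embedB (goodVecs m)) v∈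
  ... | inj₁ v∈B with ∈-map⁻ embedB v∈B
  ...   | σ , σ∈ , refl =
    embedded-good embedB (sandwich 0 m ∘ wrap m) funB (λ σ-good → sandwich-0m-wrap-IsGood σ-good 1≤m) σ∈
  nonzeroCandidates-sound v∈ | inj₂ v∈C with ∈-map⁻ embedC v∈C
  ...   | σ , σ∈ , refl =
    embedded-good embedC (sandwich m 0 ∘ wrap m) funC (λ σ-good → sandwich-m0-wrap-IsGood σ-good 1≤m)
                  (proj₁ (∈-filter⁻ startsNonzero? {xs = goodVecs m} σ∈))

  candidates-sound : ∀ {v} → v ∈ candidates → v ∈ goodVecs n
  candidates-sound v∈ with ∈-++⁻ (map embedA (goodVecs m)) v∈
  ... | inj₂ v∈' = nonzeroCandidates-sound v∈'
  ... | inj₁ v∈A with ∈-map⁻ embedA v∈A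
  ...   | σ , σ∈ , refl = embedded-good embedA (wrap m) funA wrap-IsGood σ∈

  fromIsGood : ∀ {σf} → IsGood m σf → ∃[ σ ] (σ ∈ goodVecs m × (∀ i → i < m → σf i ≡ fun σ i))
  fromIsGood {σf} σf-good =
    toVec σf bounded , Equivalence.from (∈goodVecs⇔IsGood _) (IsGood-cong σf-good σf≡) , σf≡
    where
    open IsGood σf-good using (bounded)
    σf≡ : ∀ i → i < m → σf i ≡ fun (toVec σf bounded) i
    σf≡ i i<m = sym (fun-toVec σf bounded i i<m)

  candidates-complete : ∀ {v} → v ∈ goodVecs n → v ∈ candidates
  candidates-complete {v} v∈ with decompose 2≤m (Equivalence.to (∈goodVecs⇔IsGood v) v∈)
  ... | fixesFirst σf σf-good wraps with fromIsGood σf-good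
  ...   | σ , σ∈ , σf≡σ =
    ∈-++⁺ˡ (subst (_∈ map embedA (goodVecs m)) (sym v≡) (∈-map⁺ embedA σ∈))
    where
    v≡ : v ≡ embedA σ
    v≡ = fun-injective v (embedA σ) (Wraps-agree wraps (wrapsA σ) σf≡σ)
  candidates-complete {v} v∈ | startsAt1 σf σf-good wraps with fromIsGood σf-good
  ...   | σ , σ∈ , σf≡σ =
    ∈-++⁺ʳ (map embedA (goodVecs m)) (∈-++⁺ˡ (subst (_∈ map embedB (goodVecs m)) (sym v≡) (∈-map⁺ embedB σ∈)))
    where
    v≡ : v ≡ embedB σ
    v≡ = fun-injective v (embedB σ) (sandwich-cancel 0 m ≤-refl (Wraps-agree wraps (wrapsB σ) σf≡σ))
  candidates-complete {v} v∈ | startsAbove1 σf σf-good σf0≢0 wraps with fromIsGood σf-good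
  ...   | σ , σ∈ , σf≡σ =
    ∈-++⁺ʳ (map embedA (goodVecs m)) (∈-++⁺ʳ (map embedB (goodVecs m))
      (subst (_∈ map embedC (nonzeroVecs m)) (sym v≡)
        (∈-map⁺ embedC (∈-filter⁺ startsNonzero? σ∈ (λ σ0≡0 → σf0≢0 (trans (σf≡σ 0 1≤m) σ0≡0))))))
    where
    v≡ : v ≡ embedC σ
    v≡ = fun-injective v (embedC σ) (sandwich-cancel m 0 1<n (Wraps-agree wraps (wrapsC σ) σf≡σ))

  nonzeroCandidates-unique : Unique nonzeroCandidates
  nonzeroCandidates-unique =
    Unique.++⁺ (Unique.map⁺ (embed-injective embedB (sandwich 0 m) wrapsB) (goodVecs-unique m))
               (Unique.map⁺ (embed-injective embedC (sandwich m 0) wrapsC)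
                            (Unique.filter⁺ startsNonzero? (goodVecs-unique m)))
               (λ (v∈B , v∈C) → <-irrefl (sym (startB∈ v∈B)) (startC∈ v∈C))

  candidates-unique : Unique candidates
  candidates-unique =
    Unique.++⁺ (Unique.map⁺ (embed-injective embedA (λ g → g) wrapsA) (goodVecs-unique m))
               nonzeroCandidates-unique
               (λ (v∈A , v∈nz) → nonzeroStart∈ v∈nz (startA∈ v∈A))

  nonzero⇔ : ∀ {v} → v ∈ nonzeroVecs n ⇔ v ∈ nonzeroCandidates
  nonzero⇔ {v} = mk⇔ ⇒ ⇐
    where
    ⇒ : v ∈ nonzeroVecs n → v ∈ nonzeroCandidates
    ⇒ v∈ with ∈-filter⁻ startsNonzero? {xs = goodVecs n} v∈
    ... | v∈good , v0≢0 with ∈-++⁻ (map embedA (goodVecs m)) (candidates-complete v∈good)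
    ...   | inj₁ v∈A  = contradiction (startA∈ v∈A) v0≢0
    ...   | inj₂ v∈nz = v∈nz
    ⇐ : v ∈ nonzeroCandidates → v ∈ nonzeroVecs n
    ⇐ v∈ = ∈-filter⁺ startsNonzero? (nonzeroCandidates-sound v∈) (nonzeroStart∈ v∈)

  nonzeroCandidates-length : length nonzeroCandidates ≡ length (goodVecs m) + length (nonzeroVecs m)
  nonzeroCandidates-length =
    trans (length-++ (map embedB (goodVecs m)))
          (cong₂ _+_ (length-map embedB (goodVecs m)) (length-map embedC (nonzeroVecs m)))

  goodVecs-step :
    length (goodVecs n) ≡ length (goodVecs m) + (length (goodVecs m) + length (nonzeroVecs m))
  goodVecs-step = begin
    length (goodVecs n)  ≡⟨ length-by-membership (goodVecs-unique n) candidates-unique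
                                                  (mk⇔ candidates-complete candidates-sound) ⟩
    length candidates    ≡⟨ length-++ (map embedA (goodVecs m)) ⟩
    length (map embedA (goodVecs m)) + length nonzeroCandidates
                         ≡⟨ cong₂ _+_ (length-map embedA (goodVecs m)) nonzeroCandidates-length ⟩
    length (goodVecs m) + (length (goodVecs m) + length (nonzeroVecs m)) ∎
    where open ≡-Reasoning

  nonzeroVecs-step : length (nonzeroVecs n) ≡ length (goodVecs m) + length (nonzeroVecs m)
  nonzeroVecs-step =
    trans (length-by-membership (Unique.filter⁺ startsNonzero? (goodVecs-unique n)) nonzeroCandidates-unique
                                nonzero⇔)
          nonzeroCandidates-length

goodVecs-fibonacci : ∀ j → length (goodVecs (suc (suc j))) ≡ F (suc (suc (suc j))) ×
                           length (nonzeroVecs (suc (suc j))) ≡ F (suc (suc j))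
goodVecs-fibonacci zero          = refl , refl
goodVecs-fibonacci (suc zero)    = refl , refl
goodVecs-fibonacci (suc (suc j)) with goodVecs-fibonacci j
... | total , nonzero =
  trans goodVecs-step
        (trans (cong₂ (λ t y → t + (t + y)) total nonzero) (+-comm (F (3 + j)) (F (4 + j)))) ,
  trans nonzeroVecs-step (cong₂ _+_ total nonzero)
  where open Recursion (suc (suc j)) (s≤s (s≤s z≤n))

theorem6p7 : (n : ℕ) → n ≥ 1 → countGood n ≡ F (suc n)
theorem6p7 (suc zero)    _ = refl
theorem6p7 (suc (suc j)) _ = proj₁ (goodVecs-fibonacci j)
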